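{- For every positive integer $s$ and every nonnegative integer $t$, there exists a finite simple graph $G$ with $\chi(G)=\omega(G)=s+1$, $i(G)=t$, and $\chi_l(G)=s+t+1$.
   Context: A hole is an induced cycle of length at least $4$; a graph is chordal if it has no hole. A nonempty set $X\subseteq V(G)$ is a hole cover of $G$ if every hole of $G$ contains a vertex of $X$ (for chordal $G$ any nonempty set is a hole cover). A vertex $u$ satisfies the NC property in $G$ if no hole of $G$ containing $u$ and hole of $G$ not containing $u$ share two consecutive edges; a set $\mathcal{C}$ satisfies the NC property in $G$ if each of its vertices does and every hole of $G$ contains at most one vertex of $\mathcal{C}$. Locally chordalizing a hole $H$ by a vertex $u$ on $H$ means adding an edge $uv$ for every vertex $v$ of $H$ not adjacent to $u$. For a hole cover $\mathcal{D}=\{u_1,\ldots,u_m\}$ of a graph $F$ satisfying the NC property in $F$, $\widehat{F}(\mathcal{D})$ is obtained from $F_0=F$ by letting $F_i$ be obtained from $F_{i-1}$ by locally chordalizing simultaneously all holes of $F_{i-1}$ containing $u_i$ by $u_i$, and taking $F_m$ (independent of ordering). An ordered partition $(\mathcal{C}_1,\ldots,\mathcal{C}_k)$ of a hole cover $\mathcal{C}$ of $G$ is a local chordalization partition if, setting $G_0=G_0^*=G-\mathcal{C}$ and for $i=1,\ldots,k$ letting $V(G_i)=V(G_{i-1}^*)\cup\mathcal{C}_i$, $E(G_i)=E(G_{i-1}^*)\cup E(G-\bigcup_{j=i+1}^k\mathcal{C}_j)$, $G_i^*=\widehat{G_i}(\mathcal{C}_i)$, each $\mathcal{C}_i$ is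 a hole cover of $G_i$ satisfying the NC property in $G_i$ and each $G_i^*$ is chordal. The non-chordality index $i(G)$ is $0$ if $G$ is chordal, and otherwise the smallest $k$ such that some hole cover of $G$ has a local chordalization partition into $k$ parts. $\chi$, $\chi_l$, $\omega$ denote chromatic number, list chromatic number and clique number. -}

module Defs where

open import Data.Nat using (ℕ; zero; suc; _+_; _≤_; _<_; _%_)
open import Data.Fin using (Fin; toℕ)
open import Data.Bool using (Bool; true; false; _∨_; if_then_else_)
open import Data.List using (List; []; _∷_; length)
open import Data.List.Membership.Propositional using (_∈_)
open import Data.List.Relation.Unary.All using (All)
open import Data.List.Relation.Unary.Unique.Propositional using (Unique)
open import Data.Product using (Σ; Σ-syntax; ∃; _×_; _,_)
open import Data.Sum using (_⊎_)
open import Data.Unit using (⊤)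
open import Data.Empty using (⊥)
open import Relation.Nullary using (¬_)
open import Relation.Binary.PropositionalEquality using (_≡_; _≢_)
open import Function.Bundles using (_⇔_)
open import Function.Definitions using (Injective)

record Graph : Set where
  field
    n      : ℕ
    adj    : Fin n → Fin n → Bool
    sym    : ∀ x y → adj x y ≡ adj y x
    irrefl : ∀ x → adj x x ≡ false

-- Vertices not belonging to a subgraph
-- are represented as isolated vertices (they never lie on holes).
Adj : ℕ → Set₁
Adj n = Fin n → Fin n → Set

Sub : ℕ → Set
Sub n = Fin n → Bool

Edge : (G : Graph) → Adj (Graph.n G)
Edge G x y = Graph.adj G x y ≡ true

CycAdj : (m : ℕ) → Fin (4 + m) → Fin (4 + m) → Set
CycAdj m i j = (toℕ j ≡ suc (toℕ i) % (4 + m)) ⊎ (toℕ i ≡ suc (toℕ j) % (4 + m))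

record Hole {n : ℕ} (A : Adj n) : Set where
  field
    m       : ℕ
    vs      : Fin (4 + m) → Fin n
    inj     : Injective _≡_ _≡_ vs
    induced : ∀ i j → A (vs i) (vs j) ⇔ CycAdj m i j

InHole : {n : ℕ} {A : Adj n} → Hole A → Fin n → Set
InHole H u = ∃ λ i → Hole.vs H i ≡ u

HoleEdge : {n : ℕ} {A : Adj n} → Hole A → Fin n → Fin n → Set
HoleEdge H x y = Σ[ i ∈ _ ] Σ[ j ∈ _ ] CycAdj (Hole.m H) i j × Hole.vs H i ≡ x × Hole.vs H j ≡ y

ShareTwoConsecutive : {n : ℕ} {A : Adj n} → Hole A → Hole A → Set
ShareTwoConsecutive H₁ H₂ = Σ[ x ∈ _ ] Σ[ y ∈ _ ] Σ[ z ∈ _ ]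
  (x ≢ z × HoleEdge H₁ x y × HoleEdge H₁ y z × HoleEdge H₂ x y × HoleEdge H₂ y z)

Chordal : {n : ℕ} → Adj n → Set
Chordal A = ¬ Hole A

HoleCover : {n : ℕ} → Adj n → Sub n → Set
HoleCover A X = (∃ λ u → X u ≡ true) × (∀ (H : Hole A) → ∃ λ i → X (Hole.vs H i) ≡ true)

NCvertex : {n : ℕ} → Adj n → Fin n → Set
NCvertex A u = ∀ (H₁ H₂ : Hole A) → InHole H₁ u → ¬ InHole H₂ u → ¬ ShareTwoConsecutive H₁ H₂

NCset : {n : ℕ} → Adj n → Sub n → Set
NCset A X = (∀ u → X u ≡ true → NCvertex A u)
          × (∀ (H : Hole A) u v → InHole H u → InHole H v → X u ≡ true → X v ≡ true → u ≡ v)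

chordalizeAt : {n : ℕ} → Adj n → Fin n → Adj n
chordalizeAt A u x y =
  A x y
  ⊎ (x ≡ u × y ≢ u × Σ[ H ∈ Hole A ] (InHole H u × InHole H y))
  ⊎ (y ≡ u × x ≢ u × Σ[ H ∈ Hole A ] (InHole H u × InHole H x))

-- process the vertices of D in the (canonical) increasing order of Fin n
hatList : {n : ℕ} → Sub n → List (Fin n) → Adj n → Adj n
hatList D [] A = A
hatList D (u ∷ us) A = hatList D us (if D u then chordalizeAt A u else A)

hat : {n : ℕ} → Adj n → Sub n → Adj n
hat {n} A D = hatList D (Data.List.allFin n) A

⋃ : {n : ℕ} → List (Sub n) → Sub n
⋃ [] x = false
⋃ (C ∷ Cs) x = C x ∨ ⋃ Cs x

delete : {n : ℕ} → Adj n → Sub n → Adj n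
delete A X x y = A x y × X x ≡ false × X y ≡ false

_∪ᴬ_ : {n : ℕ} → Adj n → Adj n → Adj n
(A ∪ᴬ B) x y = A x y ⊎ B x y

NonemptySub : {n : ℕ} → Sub n → Set
NonemptySub X = ∃ λ u → X u ≡ true

PairwiseDisjoint : {n : ℕ} → List (Sub n) → Set
PairwiseDisjoint [] = ⊤
PairwiseDisjoint (C ∷ Cs) = (∀ x → C x ≡ true → ⋃ Cs x ≡ false) × PairwiseDisjoint Cs

-- LCPsteps G A (Cᵢ ∷ Cᵢ₊₁ ∷ … ∷ Cₖ): A is G*ᵢ₋₁
LCPsteps : {n : ℕ} → Adj n → Adj n → List (Sub n) → Set
LCPsteps G A [] = ⊤
LCPsteps G A (C ∷ Cs) =
  HoleCover (A ∪ᴬ delete G (⋃ Cs)) C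
  × NCset (A ∪ᴬ delete G (⋃ Cs)) C
  × Chordal (hat (A ∪ᴬ delete G (⋃ Cs)) C)
  × LCPsteps G (hat (A ∪ᴬ delete G (⋃ Cs)) C) Cs

IsLCP : (G : Graph) → List (Sub (Graph.n G)) → Set
IsLCP G Cs =
  All NonemptySub Cs
  × PairwiseDisjoint Cs
  × HoleCover (Edge G) (⋃ Cs)
  × LCPsteps (Edge G) (delete (Edge G) (⋃ Cs)) Cs

HasLCP : Graph → ℕ → Set
HasLCP G k = Σ[ Cs ∈ List (Sub (Graph.n G)) ] (length Cs ≡ k × IsLCP G Cs)

NonChordalityIndex : Graph → ℕ → Set
NonChordalityIndex G t =
  (Chordal (Edge G) × t ≡ 0)
  ⊎ (¬ Chordal (Edge G) × HasLCP G t × (∀ k → k < t → ¬ HasLCP G k))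

Colorable : (G : Graph) → ℕ → Set
Colorable G k = Σ[ f ∈ (Fin (Graph.n G) → Fin k) ] (∀ x y → Edge G x y → f x ≢ f y)

ChromaticNumber : Graph → ℕ → Set
ChromaticNumber G m = Colorable G m × (∀ k → k < m → ¬ Colorable G k)

HasClique : (G : Graph) → ℕ → Set
HasClique G k = Σ[ f ∈ (Fin k → Fin (Graph.n G)) ] (∀ i j → i ≢ j → Edge G (f i) (f j))

CliqueNumber : Graph → ℕ → Set
CliqueNumber G m = HasClique G m × (∀ k → m < k → ¬ HasClique G k)

Choosable : (G : Graph) → ℕ → Set
Choosable G k =
  ∀ (L : Fin (Graph.n G) → List ℕ) → (∀ v → Unique (L v) × k ≤ length (L v)) →
  Σ[ f ∈ (Fin (Graph.n G) → ℕ) ] ((∀ v → f v ∈ L v) × (∀ x y → Edge G x y → f x ≢ f y))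

ListChromaticNumber : Graph → ℕ → Set
ListChromaticNumber G m = Choosable G m × (∀ k → k < m → ¬ Choosable G k)

module Submission where

-- Write s = q + 1, a = t + 1, r = a + q and N = r ^ r.  G is the join of a clique Q on q vertices with
-- the complete bipartite graph between A (a vertices) and B (N vertices, indexed by maps Fin r → Fin r).
--  * Q ∪ {one vertex of A, one of B} is a clique of size q + 2, and colouring A, B and the vertices of Q
--    with q + 2 colours shows χ = ω = q + 2.
--  * χ_l = r + 1: the r vertices of A ∪ Q can get distinct colours from lists of size r + 1, after which
--    every B-vertex still has a free colour.  Conversely give the i-th vertex of A ∪ Q the list
--    {(i, c) | c} and the B-vertex g the list {(i, g i) | i}: a choice on A ∪ Q is some map g, and then
--    the B-vertex g has no admissible colour.
--  * i(G) ≤ t: the holes of G are the squares a b a' b'.  The singletons {a₁}, …, {a_t} form a local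
--    chordalization partition: at step j every hole passes through a_j, and chordalizing joins a_j to
--    a₀, …, a_{j-1}; these vertices with Q form a clique and B stays independent, a split graph.
--  * i(G) ≥ t: a hole cover contains all but at most one vertex of a side S ∈ {A, B}.  Steps after which
--    the remaining parts still cover a side see a split graph and change nothing.  At the first other
--    step, the NC property lets a part contain at most one vertex of each hole of the current graph.
--    Either two non-adjacent vertices of the other side T survive all steps, and then the squares
--    through them show that every part contains at most one vertex of S, so there are at least
--    |S| - 1 ≥ t parts; or the current part meets both S and T on a common square, which is impossible.

open import Defs
open import Data.Nat using (ℕ; zero; suc; _+_; _^_; _≤_; _<_; z≤n; s≤s; _%_; _≡ᵇ_)
import Data.Nat.Properties as ℕ
open import Data.Nat.DivMod using (n%n≡0; m<n⇒m%n≡m; m%n<n)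
open import Data.Fin using (Fin; zero; suc; toℕ; fromℕ; inject₁; fromℕ<; _↑ˡ_; _↑ʳ_; splitAt; combine; finToFun; funToFin)
import Data.Fin.Properties as Fin
open import Data.Bool using (Bool; true; false; not; _∨_; if_then_else_)
import Data.Bool.Properties as Bool
open import Data.Sum using (_⊎_; inj₁; inj₂)
open import Data.Product using (Σ; ∃; _×_; _,_; proj₁; proj₂)
open import Data.Empty using (⊥; ⊥-elim)
open import Data.Unit using (⊤; tt)
open import Data.List using (List; []; _∷_; length; map; allFin; _++_; [_])
open import Data.List.Properties using (length-map; length-++; length-tabulate)
open import Data.List.Membership.Propositional using (_∈_; _∉_)
open import Data.List.Membership.Propositional.Properties using (∈-∃++; ∈-++⁻; ∈-++⁺ˡ; ∈-++⁺ʳ; ∈-map⁺; ∈-map⁻; ∈-allFin)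
open import Data.List.Membership.DecPropositional ℕ._≟_ using (_∈?_)
open import Data.List.Relation.Unary.Any using (here; there)
open import Data.List.Relation.Unary.All using (All; []; _∷_)
import Data.List.Relation.Unary.All as All
open import Data.List.Relation.Unary.AllPairs using (_∷_)
open import Data.List.Relation.Unary.Unique.Propositional using (Unique)
import Data.List.Relation.Unary.Unique.Propositional.Properties as Unique
open import Relation.Nullary using (¬_; yes; no; Dec)
open import Relation.Nullary.Decidable using (⌊_⌋)
open import Relation.Binary.PropositionalEquality using (_≡_; _≢_; refl; sym; trans; cong; subst)
open import Function using (_∘_)
open import Function.Bundles using (_⇔_; mk⇔; Equivalence)
import Function.Properties.Equivalence as ⇔

open Equivalence using (to; from)

not-true : ∀ {b} → not b ≡ true → b ≡ false
not-true {false} refl = refl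

not-false : ∀ {b} → b ≡ false → not b ≡ true
not-false refl = refl

true≢false : true ≢ false
true≢false ()

∨-false : ∀ {b c} → b ∨ c ≡ false → b ≡ false × c ≡ false
∨-false {b} {c} e = Bool.∨-conicalˡ b c e , Bool.∨-conicalʳ b c e

∨-true : ∀ {b c} → b ∨ c ≡ true → c ≡ false → b ≡ true
∨-true {true} _ _ = refl
∨-true {false} e refl = e

count : (p : ℕ) → (Fin p → Bool) → ℕ
count zero P = 0
count (suc p) P = (if P zero then 1 else 0) + count p (λ i → P (suc i))

count-∨ : ∀ p (P Q : Fin p → Bool) → count p (λ i → P i ∨ Q i) ≤ count p P + count p Q
count-∨ zero P Q = z≤n
count-∨ (suc p) P Q with P zero | Q zero | count-∨ p (λ i → P (suc i)) (λ i → Q (suc i))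
... | false | false | h = h
... | false | true | h = ℕ.≤-trans (s≤s h) (ℕ.≤-reflexive (sym (ℕ.+-suc (count p (λ i → P (suc i))) _)))
... | true | false | h = s≤s h
... | true | true | h = s≤s (ℕ.≤-trans h (ℕ.+-monoʳ-≤ (count p (λ i → P (suc i))) (ℕ.n≤1+n _)))

count-complement : ∀ p (P : Fin p → Bool) → count p P + count p (λ i → not (P i)) ≡ p
count-complement zero P = refl
count-complement (suc p) P with P zero | count-complement p (λ i → P (suc i))
... | true | h = cong suc h
... | false | h = trans (ℕ.+-suc _ _) (cong suc h)

count-none : ∀ p (P : Fin p → Bool) → (∀ i → P i ≡ false) → count p P ≡ 0
count-none zero P h = refl
count-none (suc p) P h rewrite h zero = count-none p (λ i → P (suc i)) (λ i → h (suc i))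

TwoOf : ∀ {p} → (Fin p → Bool) → Set
TwoOf {p} P = Σ (Fin p) λ i → Σ (Fin p) λ j → i ≢ j × P i ≡ true × P j ≡ true

AtMostOne : ∀ {p} → (Fin p → Bool) → Set
AtMostOne {p} P = ∀ i j → P i ≡ true → P j ≡ true → i ≡ j

count-atMostOne : ∀ p (P : Fin p → Bool) → AtMostOne P → count p P ≤ 1
count-atMostOne zero P h = z≤n
count-atMostOne (suc p) P h with P zero in first
... | false = count-atMostOne p (λ i → P (suc i)) (λ i j a b → Fin.suc-injective (h (suc i) (suc j) a b))
... | true = ℕ.≤-reflexive (cong suc (count-none p _ rest))
  where
  rest : ∀ i → P (suc i) ≡ false
  rest i with P (suc i) in other
  ... | false = refl
  ... | true with h zero (suc i) first other
  ...   | ()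

twoOrAtMostOne : ∀ {p} (P : Fin p → Bool) → TwoOf P ⊎ AtMostOne P
twoOrAtMostOne {p} P with Fin.any? (λ i → Fin.any? (λ j → witness? i j))
  where
  witness? : ∀ i j → Dec (i ≢ j × P i ≡ true × P j ≡ true)
  witness? i j with i Fin.≟ j | P i | P j
  ... | yes e | _ | _ = no (λ w → proj₁ w e)
  ... | no ne | true | true = yes (ne , refl , refl)
  ... | no ne | false | _ = no (λ { (_ , () , _) })
  ... | no ne | true | false = no (λ { (_ , _ , ()) })
... | yes (i , j , w) = inj₁ (i , j , w)
... | no none = inj₂ atMostOne
  where
  atMostOne : AtMostOne P
  atMostOne i j pi pj with i Fin.≟ j
  ... | yes e = e
  ... | no ne = ⊥-elim (none (i , j , ne , pi , pj))

record Entering {p : ℕ} (P Q : Fin p → Bool) : Set where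
  field
    z z' : Fin p
    z≢z' : z ≢ z'
    z∈Q : Q z ≡ true
    z∉P : P z ≡ false
    z'∉P : P z' ≡ false

enteringPair : ∀ {p} (P Q : Fin p → Bool) → TwoOf (λ i → not (P i)) → AtMostOne (λ i → not (Q i)) → Entering P Q
enteringPair P Q (i , j , i≢j , i∉P , j∉P) atMostOne with Q i in i∈Q | Q j in j∈Q
... | true | _ = record { z = i ; z' = j ; z≢z' = i≢j ; z∈Q = i∈Q ; z∉P = not-true i∉P ; z'∉P = not-true j∉P }
... | false | true = record { z = j ; z' = i ; z≢z' = λ e → i≢j (sym e) ; z∈Q = j∈Q ; z∉P = not-true j∉P ; z'∉P = not-true i∉P }
... | false | false = ⊥-elim (i≢j (atMostOne i j (not-false i∈Q) (not-false j∈Q)))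

freshElement : (xs ys : List ℕ) → Unique xs → length ys < length xs → ∃ λ x → x ∈ xs × x ∉ ys
freshElement [] ys u ()
freshElement (x ∷ xs) ys (x∉xs ∷ u) longer with x ∈? ys
... | no x∉ys = x , here refl , x∉ys
... | yes x∈ys with ∈-∃++ x∈ys
...   | us , vs , refl with freshElement xs (us ++ vs) u (shorter longer)
  where
  shorter : length (us ++ [ x ] ++ vs) < suc (length xs) → length (us ++ vs) < length xs
  shorter h rewrite length-++ us {[ x ] ++ vs} | length-++ us {vs} | ℕ.+-suc (length us) (length vs) = ℕ.≤-pred h
...     | y , y∈xs , y∉us++vs = y , there y∈xs , y∉ys
  where
  y∉ys : y ∉ us ++ [ x ] ++ vs
  y∉ys h with ∈-++⁻ us h
  ... | inj₁ y∈us = y∉us++vs (∈-++⁺ˡ y∈us)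
  ... | inj₂ (here refl) = All.lookup x∉xs y∈xs refl
  ... | inj₂ (there y∈vs) = y∉us++vs (∈-++⁺ʳ us y∈vs)

length-allFin : ∀ k → length (allFin k) ≡ k
length-allFin k = length-tabulate (λ i → i)

-- the image of a k-vertex colouring is a list of length k, so longer lists have a fresh colour
freshColour : ∀ {k} (g : Fin k → ℕ) (L : List ℕ) → Unique L → suc k ≤ length L →
  ∃ λ c → c ∈ L × ∀ i → g i ≢ c
freshColour {k} g L u long with freshElement L (map g (allFin k)) u
  (ℕ.≤-trans (s≤s (ℕ.≤-reflexive (trans (length-map g (allFin k)) (length-allFin k)))) long)
... | c , c∈L , c∉img = c , c∈L , λ i e → c∉img (subst (_∈ map g (allFin k)) e (∈-map⁺ g (∈-allFin i)))

-- greedily: the first vertex takes a colour missing from the choice for the other k - 1 vertices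
distinctChoice : ∀ k (L : Fin k → List ℕ) → (∀ i → Unique (L i) × k ≤ length (L i)) →
  Σ (Fin k → ℕ) λ g → (∀ i → g i ∈ L i) × (∀ i j → i ≢ j → g i ≢ g j)
distinctChoice zero L h = (λ ()) , (λ ()) , (λ ())
distinctChoice (suc k) L h with distinctChoice k (λ i → L (suc i)) (λ i → proj₁ (h (suc i)) , ℕ.≤-trans (ℕ.n≤1+n k) (proj₂ (h (suc i))))
... | g , g∈L , g-distinct with freshColour g (L zero) (proj₁ (h zero)) (proj₂ (h zero))
... | c , c∈L , c-fresh = extend , extend∈L , extend-distinct
  where
  extend : Fin (suc k) → ℕ
  extend zero = c
  extend (suc i) = g i
  extend∈L : ∀ i → extend i ∈ L i
  extend∈L zero = c∈L
  extend∈L (suc i) = g∈L i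
  extend-distinct : ∀ i j → i ≢ j → extend i ≢ extend j
  extend-distinct zero zero ne _ = ne refl
  extend-distinct zero (suc j) ne e = c-fresh j (sym e)
  extend-distinct (suc i) zero ne e = c-fresh i e
  extend-distinct (suc i) (suc j) ne e = g-distinct i j (λ i≡j → ne (cong suc i≡j)) e

-- Squares.  The positions of a 4-cycle split into two sides: 0, 2 (left) and 1, 3 (right); two
-- positions are consecutive exactly when they lie on opposite sides.

cornerOf : Fin 4 → Fin 2 ⊎ Fin 2
cornerOf zero = inj₁ zero
cornerOf (suc zero) = inj₂ zero
cornerOf (suc (suc zero)) = inj₁ (suc zero)
cornerOf (suc (suc (suc zero))) = inj₂ (suc zero)

positionOf : Fin 2 ⊎ Fin 2 → Fin 4
positionOf (inj₁ zero) = zero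
positionOf (inj₂ zero) = suc zero
positionOf (inj₁ (suc zero)) = suc (suc zero)
positionOf (inj₂ (suc zero)) = suc (suc (suc zero))

positionOf-cornerOf : ∀ i → positionOf (cornerOf i) ≡ i
positionOf-cornerOf zero = refl
positionOf-cornerOf (suc zero) = refl
positionOf-cornerOf (suc (suc zero)) = refl
positionOf-cornerOf (suc (suc (suc zero))) = refl

Opposite : Fin 2 ⊎ Fin 2 → Fin 2 ⊎ Fin 2 → Set
Opposite (inj₁ _) (inj₁ _) = ⊥
Opposite (inj₁ _) (inj₂ _) = ⊤
Opposite (inj₂ _) (inj₁ _) = ⊤
Opposite (inj₂ _) (inj₂ _) = ⊥

nextPosition : ∀ {i j} → toℕ j ≡ suc (toℕ i) % 4 → CycAdj 0 i j ⇔ ⊤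
nextPosition e = mk⇔ (λ _ → tt) (λ _ → inj₁ e)

previousPosition : ∀ {i j} → toℕ i ≡ suc (toℕ j) % 4 → CycAdj 0 i j ⇔ ⊤
previousPosition e = mk⇔ (λ _ → tt) (λ _ → inj₂ e)

farPositions : ∀ {i j} → ¬ CycAdj 0 i j → CycAdj 0 i j ⇔ ⊥
farPositions nc = mk⇔ nc ⊥-elim

cycAdj⇔opposite : ∀ i j → CycAdj 0 i j ⇔ Opposite (cornerOf i) (cornerOf j)
cycAdj⇔opposite zero zero = farPositions λ { (inj₁ ()) ; (inj₂ ()) }
cycAdj⇔opposite zero (suc zero) = nextPosition refl
cycAdj⇔opposite zero (suc (suc zero)) = farPositions λ { (inj₁ ()) ; (inj₂ ()) }
cycAdj⇔opposite zero (suc (suc (suc zero))) = previousPosition refl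
cycAdj⇔opposite (suc zero) zero = previousPosition refl
cycAdj⇔opposite (suc zero) (suc zero) = farPositions λ { (inj₁ ()) ; (inj₂ ()) }
cycAdj⇔opposite (suc zero) (suc (suc zero)) = nextPosition refl
cycAdj⇔opposite (suc zero) (suc (suc (suc zero))) = farPositions λ { (inj₁ ()) ; (inj₂ ()) }
cycAdj⇔opposite (suc (suc zero)) zero = farPositions λ { (inj₁ ()) ; (inj₂ ()) }
cycAdj⇔opposite (suc (suc zero)) (suc zero) = previousPosition refl
cycAdj⇔opposite (suc (suc zero)) (suc (suc zero)) = farPositions λ { (inj₁ ()) ; (inj₂ ()) }
cycAdj⇔opposite (suc (suc zero)) (suc (suc (suc zero))) = nextPosition refl
cycAdj⇔opposite (suc (suc (suc zero))) zero = nextPosition refl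
cycAdj⇔opposite (suc (suc (suc zero))) (suc zero) = farPositions λ { (inj₁ ()) ; (inj₂ ()) }
cycAdj⇔opposite (suc (suc (suc zero))) (suc (suc zero)) = previousPosition refl
cycAdj⇔opposite (suc (suc (suc zero))) (suc (suc (suc zero))) = farPositions λ { (inj₁ ()) ; (inj₂ ()) }

module _ {n : ℕ} where

  record Square (R : Adj n) (s t : Fin 2 → Fin n) : Set where
    field
      s-distinct : s zero ≢ s (suc zero)
      t-distinct : t zero ≢ t (suc zero)
      st : ∀ i j → R (s i) (t j)
      ts : ∀ i j → R (t j) (s i)
      ¬ss : ∀ i j → ¬ R (s i) (s j)
      ¬tt : ∀ i j → ¬ R (t i) (t j)

  corner : (s t : Fin 2 → Fin n) → Fin 2 ⊎ Fin 2 → Fin n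
  corner s t (inj₁ i) = s i
  corner s t (inj₂ j) = t j

  pair-injective : (f : Fin 2 → Fin n) → f zero ≢ f (suc zero) → ∀ {i j} → f i ≡ f j → i ≡ j
  pair-injective f ne {zero} {zero} e = refl
  pair-injective f ne {zero} {suc zero} e = ⊥-elim (ne e)
  pair-injective f ne {suc zero} {zero} e = ⊥-elim (ne (sym e))
  pair-injective f ne {suc zero} {suc zero} e = refl

  squareHole : {R : Adj n} {s t : Fin 2 → Fin n} → Square R s t → Hole R
  squareHole {R} {s} {t} sq = record
    { m = 0
    ; vs = corner s t ∘ cornerOf
    ; inj = λ {i} {j} e → trans (sym (positionOf-cornerOf i))
                            (trans (cong positionOf (corner-injective e)) (positionOf-cornerOf j))
    ; induced = λ i j → ⇔.trans (related⇔opposite (cornerOf i) (cornerOf j)) (⇔.sym (cycAdj⇔opposite i j))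
    }
    where
    open Square sq
    s≢t : ∀ i j → s i ≢ t j
    s≢t i j e = ¬ss i i (subst (R (s i)) (sym e) (st i j))
    corner-injective : ∀ {x y} → corner s t x ≡ corner s t y → x ≡ y
    corner-injective {inj₁ i} {inj₁ j} e = cong inj₁ (pair-injective s s-distinct e)
    corner-injective {inj₁ i} {inj₂ j} e = ⊥-elim (s≢t i j e)
    corner-injective {inj₂ i} {inj₁ j} e = ⊥-elim (s≢t j i (sym e))
    corner-injective {inj₂ i} {inj₂ j} e = cong inj₂ (pair-injective t t-distinct e)
    related⇔opposite : ∀ x y → R (corner s t x) (corner s t y) ⇔ Opposite x y
    related⇔opposite (inj₁ i) (inj₁ j) = mk⇔ (¬ss i j) ⊥-elim
    related⇔opposite (inj₁ i) (inj₂ j) = mk⇔ (λ _ → tt) (λ _ → st i j)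
    related⇔opposite (inj₂ i) (inj₁ j) = mk⇔ (λ _ → tt) (λ _ → ts j i)
    related⇔opposite (inj₂ i) (inj₂ j) = mk⇔ (¬tt i j) ⊥-elim

module CyclePositions (m : ℕ) where

  first second third last penult : Fin (4 + m)
  first = zero
  second = suc zero
  third = suc (suc zero)
  last = fromℕ (3 + m)
  penult = inject₁ (fromℕ (2 + m))

  toℕ-last : toℕ last ≡ 3 + m
  toℕ-last = Fin.toℕ-fromℕ (3 + m)

  toℕ-penult : toℕ penult ≡ 2 + m
  toℕ-penult = trans (Fin.toℕ-inject₁ (fromℕ (2 + m))) (Fin.toℕ-fromℕ (2 + m))

  last-wraps : suc (toℕ last) % (4 + m) ≡ 0
  last-wraps = subst (λ z → suc z % (4 + m) ≡ 0) (sym toℕ-last) (n%n≡0 (4 + m))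

  penult-steps : suc (toℕ penult) % (4 + m) ≡ 3 + m
  penult-steps = subst (λ z → suc z % (4 + m) ≡ 3 + m) (sym toℕ-penult) (m<n⇒m%n≡m (ℕ.n<1+n (3 + m)))

  second~first : CycAdj m second first
  second~first = inj₂ refl

  second~third : CycAdj m second third
  second~third = inj₁ refl

  last~first : CycAdj m last first
  last~first = inj₁ (sym last-wraps)

  last~penult : CycAdj m last penult
  last~penult = inj₂ (trans toℕ-last (sym penult-steps))

  second≁last : ¬ CycAdj m second last
  second≁last (inj₁ e) with trans (sym toℕ-last) e
  ... | ()
  second≁last (inj₂ e) with trans e last-wraps
  ... | ()

  first≁third : ¬ CycAdj m first third
  first≁third (inj₁ ())
  first≁third (inj₂ ())

  penult≁first : ¬ CycAdj m penult first
  penult≁first (inj₁ e) with trans e penult-steps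
  ... | ()
  penult≁first (inj₂ e) with trans (sym toℕ-penult) e
  ... | ()

  second≢last : toℕ second ≢ toℕ last
  second≢last e with trans e toℕ-last
  ... | ()

  first≢third : toℕ first ≢ toℕ third
  first≢third ()

  penult≢first : toℕ penult ≢ toℕ first
  penult≢first e with trans (sym toℕ-penult) e
  ... | ()

module _ {n : ℕ} where

  -- The second and last vertices of a hole are non-adjacent, so one of them lies in I; its two
  -- hole-neighbours then lie in K, but they are non-adjacent.
  splitNoHole : {R : Adj n} (K I : Fin n → Set) →
    (∀ x y → K x → K y → x ≢ y → R x y) → (∀ x y → I x → I y → ¬ R x y) →
    (H : Hole R) → ¬ (∀ i → K (Hole.vs H i) ⊎ I (Hole.vs H i))
  splitNoHole {R} K I clique independent H split = excluded (split second) (split last)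
    where
    open Hole H using (m; vs; inj; induced)
    open CyclePositions m
    bothInK : ∀ {i j} → ¬ CycAdj m i j → toℕ i ≢ toℕ j → K (vs i) → K (vs j) → ⊥
    bothInK nc ne ki kj = nc (to (induced _ _) (clique _ _ ki kj (λ e → ne (cong toℕ (inj e)))))
    neighbourInK : ∀ {i j} → CycAdj m i j → I (vs i) → K (vs j)
    neighbourInK {i} {j} c ii with split j
    ... | inj₁ kj = kj
    ... | inj₂ ij = ⊥-elim (independent _ _ ii ij (from (induced i j) c))
    excluded : K (vs second) ⊎ I (vs second) → K (vs last) ⊎ I (vs last) → ⊥
    excluded (inj₁ k₂) (inj₁ kℓ) = bothInK second≁last second≢last k₂ kℓ
    excluded (inj₂ i₂) _ = bothInK first≁third first≢third (neighbourInK second~first i₂) (neighbourInK second~third i₂)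
    excluded (inj₁ _) (inj₂ iℓ) = bothInK penult≁first penult≢first (neighbourInK last~penult iℓ) (neighbourInK last~first iℓ)

module _ {n : ℕ} where

  NonIsolated : Adj n → Fin n → Set
  NonIsolated R x = ∃ λ w → R x w

  inHole⇒nonIsolated : {R : Adj n} (H : Hole R) {y : Fin n} → InHole H y → NonIsolated R y
  inHole⇒nonIsolated {R} H (i , refl) = Hole.vs H next , from (Hole.induced H i next) (inj₁ (Fin.toℕ-fromℕ< _))
    where
    next : Fin (4 + Hole.m H)
    next = fromℕ< (m%n<n (suc (toℕ i)) (4 + Hole.m H))

  transportHole : {R R' : Adj n} → (∀ x y → R x y → R' x y) → (∀ x y → R' x y → R x y) → Hole R → Hole R'
  transportHole f g H = record
    { m = Hole.m H ; vs = Hole.vs H ; inj = Hole.inj H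
    ; induced = λ i j → mk⇔ (λ r → to (Hole.induced H i j) (g _ _ r)) (λ c → f _ _ (from (Hole.induced H i j) c)) }

  NewChord : Adj n → Sub n → Fin n → Fin n → Set
  NewChord R D x y = x ≢ y × NonIsolated R x × NonIsolated R y × (D x ≡ true ⊎ D y ≡ true)

  chordalizeAt-⊆ : (R : Adj n) (u x y : Fin n) → chordalizeAt R u x y →
    R x y ⊎ (x ≢ y × NonIsolated R x × NonIsolated R y × (x ≡ u ⊎ y ≡ u))
  chordalizeAt-⊆ R u x y (inj₁ e) = inj₁ e
  chordalizeAt-⊆ R u x y (inj₂ (inj₁ (refl , y≢u , H , u∈H , y∈H))) =
    inj₂ ((λ e → y≢u (sym e)) , inHole⇒nonIsolated H u∈H , inHole⇒nonIsolated H y∈H , inj₁ refl)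
  chordalizeAt-⊆ R u x y (inj₂ (inj₂ (refl , x≢u , H , u∈H , x∈H))) =
    inj₂ (x≢u , inHole⇒nonIsolated H x∈H , inHole⇒nonIsolated H u∈H , inj₂ refl)

  step-⊆ : (R : Adj n) (D : Sub n) (u x y : Fin n) →
    (if D u then chordalizeAt R u else R) x y → R x y ⊎ NewChord R D x y
  step-⊆ R D u x y h with D u in u∈D
  ... | false = inj₁ h
  ... | true with chordalizeAt-⊆ R u x y h
  ...   | inj₁ e = inj₁ e
  ...   | inj₂ (ne , nx , ny , inj₁ refl) = inj₂ (ne , nx , ny , inj₁ u∈D)
  ...   | inj₂ (ne , nx , ny , inj₂ refl) = inj₂ (ne , nx , ny , inj₂ u∈D)

  nonIsolated-pullback : (R R' : Adj n) (D : Sub n) → (∀ x y → R' x y → R x y ⊎ NewChord R D x y) →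
    ∀ x → NonIsolated R' x → NonIsolated R x
  nonIsolated-pullback R R' D f x (w , e) with f x w e
  ... | inj₁ e' = w , e'
  ... | inj₂ (_ , nx , _) = nx

  hatList-⊆ : (D : Sub n) (us : List (Fin n)) (R : Adj n) (x y : Fin n) →
    hatList D us R x y → R x y ⊎ NewChord R D x y
  hatList-⊆ D [] R x y h = inj₁ h
  hatList-⊆ D (u ∷ us) R x y h with hatList-⊆ D us _ x y h
  ... | inj₁ e = step-⊆ R D u x y e
  ... | inj₂ (ne , nx , ny , d) = inj₂ (ne , pullback x nx , pullback y ny , d)
    where
    pullback = nonIsolated-pullback R _ D (step-⊆ R D u)

  hat-⊆ : (R : Adj n) (D : Sub n) (x y : Fin n) → hat R D x y → R x y ⊎ NewChord R D x y
  hat-⊆ R D = hatList-⊆ D (allFin n) R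

  hatList-⊇ : (D : Sub n) (us : List (Fin n)) (R : Adj n) (x y : Fin n) → R x y → hatList D us R x y
  hatList-⊇ D [] R x y e = e
  hatList-⊇ D (u ∷ us) R x y e = hatList-⊇ D us _ x y (kept (D u))
    where
    kept : (b : Bool) → (if b then chordalizeAt R u else R) x y
    kept false = e
    kept true = inj₁ e

  hat-⊇ : (R : Adj n) (D : Sub n) (x y : Fin n) → R x y → hat R D x y
  hat-⊇ R D = hatList-⊇ D (allFin n) R

  hatList-chordal : (D : Sub n) (us : List (Fin n)) (R : Adj n) → Chordal R → (x y : Fin n) → hatList D us R x y → R x y
  hatList-chordal D [] R chordal x y h = h
  hatList-chordal D (u ∷ us) R chordal x y h with D u
  ... | false = hatList-chordal D us R chordal x y h
  ... | true = noNewEdge x y (hatList-chordal D us (chordalizeAt R u) (chordal ∘ transportHole noNewEdge (λ _ _ → inj₁)) x y h)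
    where
    noNewEdge : ∀ x y → chordalizeAt R u x y → R x y
    noNewEdge x y (inj₁ e) = e
    noNewEdge x y (inj₂ (inj₁ (_ , _ , H , _))) = ⊥-elim (chordal H)
    noNewEdge x y (inj₂ (inj₂ (_ , _ , H , _))) = ⊥-elim (chordal H)

  -- a chordal relation has no holes to chordalize
  hat-chordal : (R : Adj n) (D : Sub n) → Chordal R → (x y : Fin n) → hat R D x y → R x y
  hat-chordal R D = hatList-chordal D (allFin n) R

  hatList-singleton : (D : Sub n) (c : Fin n) → (∀ u → D u ≡ true → u ≡ c) → D c ≡ true →
    (us : List (Fin n)) → c ∈ us → (R : Adj n) (x y : Fin n) → chordalizeAt R c x y → hatList D us R x y
  hatList-singleton D c only c∈D (u ∷ us) c∈us R x y h with D u in u∈D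
  ... | true with only u u∈D
  ...   | refl = hatList-⊇ D us _ x y h
  hatList-singleton D c only c∈D (u ∷ us) (here refl) R x y h | false with trans (sym c∈D) u∈D
  ... | ()
  hatList-singleton D c only c∈D (u ∷ us) (there c∈us) R x y h | false = hatList-singleton D c only c∈D us c∈us R x y h

  hat-singleton : (R : Adj n) (D : Sub n) (c : Fin n) → (∀ u → D u ≡ true → u ≡ c) → D c ≡ true →
    (x y : Fin n) → chordalizeAt R c x y → hat R D x y
  hat-singleton R D c only c∈D = hatList-singleton D c only c∈D (allFin n) (∈-allFin c) R

data Kind (a q N : ℕ) : Set where
  kA : Fin a → Kind a q N
  kQ : Fin q → Kind a q N
  kB : Fin N → Kind a q N

adjKind : ∀ {a q N} → Kind a q N → Kind a q N → Bool
adjKind (kA _) (kA _) = false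
adjKind (kQ k) (kQ k') = not ⌊ k Fin.≟ k' ⌋
adjKind (kB _) (kB _) = false
adjKind (kA _) (kQ _) = true
adjKind (kA _) (kB _) = true
adjKind (kQ _) (kA _) = true
adjKind (kQ _) (kB _) = true
adjKind (kB _) (kA _) = true
adjKind (kB _) (kQ _) = true

adjKind-sym : ∀ {a q N} (x y : Kind a q N) → adjKind x y ≡ adjKind y x
adjKind-sym (kA _) (kA _) = refl
adjKind-sym (kA _) (kQ _) = refl
adjKind-sym (kA _) (kB _) = refl
adjKind-sym (kQ _) (kA _) = refl
adjKind-sym (kQ k) (kQ k') with k Fin.≟ k' | k' Fin.≟ k
... | yes _ | yes _ = refl
... | no _ | no _ = refl
... | yes e | no ne = ⊥-elim (ne (sym e))
... | no ne | yes e = ⊥-elim (ne (sym e))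
adjKind-sym (kQ _) (kB _) = refl
adjKind-sym (kB _) (kA _) = refl
adjKind-sym (kB _) (kQ _) = refl
adjKind-sym (kB _) (kB _) = refl

adjKind-irrefl : ∀ {a q N} (x : Kind a q N) → adjKind x x ≡ false
adjKind-irrefl (kA _) = refl
adjKind-irrefl (kQ k) with k Fin.≟ k
... | yes _ = refl
... | no ne = ⊥-elim (ne refl)
adjKind-irrefl (kB _) = refl

module Construction (q t : ℕ) where

  a r : ℕ
  a = suc t
  r = a + q

  opaque
    N : ℕ
    N = r ^ r

    toFun : Fin N → Fin r → Fin r
    toFun b = finToFun {r} {r} b

    fromFun : (Fin r → Fin r) → Fin N
    fromFun g = funToFin {r} {r} g

    toFun-fromFun : ∀ g i → toFun (fromFun g) i ≡ g i
    toFun-fromFun g i = Fin.finToFun-funToFin {r} {r} g i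

    r≤N : r ≤ N
    r≤N = ℕ.m≤m*n r (r ^ (t + q)) {{ℕ.m^n≢0 r (t + q)}}

  -- the vertices Fin (r + N): the core A ∪ Q = Fin (a + q) first, then B
  n : ℕ
  n = r + N

  kindOfCore : Fin r → Kind a q N
  kindOfCore i with splitAt a i
  ... | inj₁ j = kA j
  ... | inj₂ k = kQ k

  kindOf : Fin n → Kind a q N
  kindOf v with splitAt r v
  ... | inj₁ i = kindOfCore i
  ... | inj₂ b = kB b

  G : Graph
  G = record
    { n = n ; adj = λ x y → adjKind (kindOf x) (kindOf y)
    ; sym = λ x y → adjKind-sym (kindOf x) (kindOf y)
    ; irrefl = λ x → adjKind-irrefl (kindOf x) }

  E : Adj n
  E = Edge G

  eC : Fin r → Fin n
  eC i = i ↑ˡ N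
  eA : Fin a → Fin n
  eA j = eC (j ↑ˡ q)
  eQ : Fin q → Fin n
  eQ k = eC (a ↑ʳ k)
  eB : Fin N → Fin n
  eB b = r ↑ʳ b

  kindOf-eA : ∀ j → kindOf (eA j) ≡ kA j
  kindOf-eA j rewrite Fin.splitAt-↑ˡ r (j ↑ˡ q) N | Fin.splitAt-↑ˡ a j q = refl
  kindOf-eQ : ∀ k → kindOf (eQ k) ≡ kQ k
  kindOf-eQ k rewrite Fin.splitAt-↑ˡ r (a ↑ʳ k) N | Fin.splitAt-↑ʳ a q k = refl
  kindOf-eB : ∀ b → kindOf (eB b) ≡ kB b
  kindOf-eB b rewrite Fin.splitAt-↑ʳ r N b = refl

  data CoreView : Fin r → Set where
    cA : ∀ j → CoreView (j ↑ˡ q)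
    cQ : ∀ k → CoreView (a ↑ʳ k)

  coreView : ∀ i → CoreView i
  coreView i with splitAt a i in eq
  ... | inj₁ j = subst CoreView (Fin.splitAt⁻¹-↑ˡ eq) (cA j)
  ... | inj₂ k = subst CoreView (Fin.splitAt⁻¹-↑ʳ eq) (cQ k)

  data View : Fin n → Set where
    vA : ∀ j → View (eA j)
    vQ : ∀ k → View (eQ k)
    vB : ∀ b → View (eB b)

  view : ∀ v → View v
  view v with splitAt r v in eq
  ... | inj₂ b = subst View (Fin.splitAt⁻¹-↑ʳ eq) (vB b)
  ... | inj₁ i = subst View (Fin.splitAt⁻¹-↑ˡ eq) (fromCore (coreView i))
    where
    fromCore : ∀ {i} → CoreView i → View (eC i)
    fromCore (cA j) = vA j
    fromCore (cQ k) = vQ k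

  E-sym : ∀ x y → E x y → E y x
  E-sym x y e = trans (Graph.sym G y x) e

  E-irrefl : ∀ x → ¬ E x x
  E-irrefl x e = true≢false (trans (sym e) (Graph.irrefl G x))

  adjacent⇒distinct : ∀ {x y} → E x y → x ≢ y
  adjacent⇒distinct {x} e refl = E-irrefl x e

  E-AQ : ∀ j k → E (eA j) (eQ k)
  E-AQ j k rewrite kindOf-eA j | kindOf-eQ k = refl
  E-AB : ∀ j b → E (eA j) (eB b)
  E-AB j b rewrite kindOf-eA j | kindOf-eB b = refl
  E-QB : ∀ k b → E (eQ k) (eB b)
  E-QB k b rewrite kindOf-eQ k | kindOf-eB b = refl
  E-QQ : ∀ k k' → k ≢ k' → E (eQ k) (eQ k')
  E-QQ k k' ne rewrite kindOf-eQ k | kindOf-eQ k' with k Fin.≟ k'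
  ... | yes e = ⊥-elim (ne e)
  ... | no _ = refl
  ¬E-AA : ∀ j j' → ¬ E (eA j) (eA j')
  ¬E-AA j j' e rewrite kindOf-eA j | kindOf-eA j' = true≢false (sym e)
  ¬E-BB : ∀ b b' → ¬ E (eB b) (eB b')
  ¬E-BB b b' e rewrite kindOf-eB b | kindOf-eB b' = true≢false (sym e)

  E-CB : ∀ i b → E (eC i) (eB b)
  E-CB i b = core (coreView i)
    where
    core : ∀ {i} → CoreView i → E (eC i) (eB b)
    core (cA j) = E-AB j b
    core (cQ k) = E-QB k b

  eC-injective : ∀ {i j} → eC i ≡ eC j → i ≡ j
  eC-injective = Fin.↑ˡ-injective N _ _
  eA-injective : ∀ {i j} → eA i ≡ eA j → i ≡ j
  eA-injective e = Fin.↑ˡ-injective q _ _ (eC-injective e)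
  eB-injective : ∀ {i j} → eB i ≡ eB j → i ≡ j
  eB-injective = Fin.↑ʳ-injective r _ _

  eA≢eB : ∀ j b → eA j ≢ eB b
  eA≢eB j b = adjacent⇒distinct (E-AB j b)
  eA≢eQ : ∀ j k → eA j ≢ eQ k
  eA≢eQ j k = adjacent⇒distinct (E-AQ j k)

  -- χ(G) = ω(G) = q + 2: colour A by 0, B by 1 and the k-th vertex of Q by k + 2; one vertex of A,
  -- one of B and all of Q form a clique; any smaller colouring or larger clique contradicts the other
  -- by the pigeonhole principle.

  colourOfKind : Kind a q N → Fin (suc (suc q))
  colourOfKind (kA _) = zero
  colourOfKind (kB _) = suc zero
  colourOfKind (kQ k) = suc (suc k)

  colourOfKind-proper : ∀ x y → adjKind x y ≡ true → colourOfKind x ≢ colourOfKind y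
  colourOfKind-proper (kA _) (kA _) () _
  colourOfKind-proper (kA _) (kQ _) _ ()
  colourOfKind-proper (kA _) (kB _) _ ()
  colourOfKind-proper (kQ _) (kA _) _ ()
  colourOfKind-proper (kQ k) (kQ k') e refl = true≢false (trans (sym e) (adjKind-irrefl (kQ {a} {q} {N} k)))
  colourOfKind-proper (kQ _) (kB _) _ ()
  colourOfKind-proper (kB _) (kA _) _ ()
  colourOfKind-proper (kB _) (kQ _) _ ()
  colourOfKind-proper (kB _) (kB _) () _

  colouring : Colorable G (suc (suc q))
  colouring = (λ v → colourOfKind (kindOf v)) , λ x y → colourOfKind-proper (kindOf x) (kindOf y)

  b₀ : Fin N
  b₀ = fromFun (λ _ → zero)

  cliqueVertex : Fin (suc (suc q)) → Fin n
  cliqueVertex zero = eA zero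
  cliqueVertex (suc zero) = eB b₀
  cliqueVertex (suc (suc k)) = eQ k

  cliqueVertex-adjacent : ∀ i j → i ≢ j → E (cliqueVertex i) (cliqueVertex j)
  cliqueVertex-adjacent zero zero ne = ⊥-elim (ne refl)
  cliqueVertex-adjacent zero (suc zero) _ = E-AB zero b₀
  cliqueVertex-adjacent zero (suc (suc k)) _ = E-AQ zero k
  cliqueVertex-adjacent (suc zero) zero _ = E-sym (eA zero) (eB b₀) (E-AB zero b₀)
  cliqueVertex-adjacent (suc zero) (suc zero) ne = ⊥-elim (ne refl)
  cliqueVertex-adjacent (suc zero) (suc (suc k)) _ = E-sym (eQ k) (eB b₀) (E-QB k b₀)
  cliqueVertex-adjacent (suc (suc k)) zero _ = E-sym (eA zero) (eQ k) (E-AQ zero k)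
  cliqueVertex-adjacent (suc (suc k)) (suc zero) _ = E-QB k b₀
  cliqueVertex-adjacent (suc (suc k)) (suc (suc k')) ne = E-QQ k k' (λ e → ne (cong (λ z → suc (suc z)) e))

  clique : HasClique G (suc (suc q))
  clique = cliqueVertex , cliqueVertex-adjacent

  chromaticNumber : ChromaticNumber G (suc (suc q))
  chromaticNumber = colouring , λ k k<q+2 (f , proper) →
    let (i , j , i<j , same) = Fin.pigeonhole k<q+2 (f ∘ cliqueVertex)
    in proper (cliqueVertex i) (cliqueVertex j) (cliqueVertex-adjacent i j (Fin.<⇒≢ i<j)) same

  cliqueNumber : CliqueNumber G (suc (suc q))
  cliqueNumber = clique , λ k q+2<k (f , adjacent) →
    let (i , j , i<j , same) = Fin.pigeonhole q+2<k (proj₁ colouring ∘ f)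
    in proj₂ colouring (f i) (f j) (adjacent i j (Fin.<⇒≢ i<j)) same

  data CoreOrB : Fin n → Set where
    core : ∀ i → CoreOrB (eC i)
    inB : ∀ b → CoreOrB (eB b)

  coreOrB : ∀ v → CoreOrB v
  coreOrB v with splitAt r v in eq
  ... | inj₁ i = subst CoreOrB (Fin.splitAt⁻¹-↑ˡ eq) (core i)
  ... | inj₂ b = subst CoreOrB (Fin.splitAt⁻¹-↑ʳ eq) (inB b)

  -- lists of size r + 1 suffice: give the r core vertices distinct colours, then every B-vertex, whose
  -- neighbours all lie in the core, still has a colour of its list left
  choosable : Choosable G (suc r)
  choosable L sizes = colour , colour∈L , colour-proper
    where
    coreChoice = distinctChoice r (L ∘ eC) (λ i → proj₁ (sizes (eC i)) , ℕ.≤-trans (ℕ.n≤1+n r) (proj₂ (sizes (eC i))))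
    g = proj₁ coreChoice
    freshB : ∀ b → ∃ λ c → c ∈ L (eB b) × ∀ i → g i ≢ c
    freshB b = freshColour g (L (eB b)) (proj₁ (sizes (eB b))) (proj₂ (sizes (eB b)))
    colourOf : ∀ {v} → CoreOrB v → ℕ
    colourOf (core i) = g i
    colourOf (inB b) = proj₁ (freshB b)
    colour : Fin n → ℕ
    colour v = colourOf (coreOrB v)
    inList : ∀ {v} (c : CoreOrB v) → colourOf c ∈ L v
    inList (core i) = proj₁ (proj₂ coreChoice) i
    inList (inB b) = proj₁ (proj₂ (freshB b))
    colour∈L : ∀ v → colour v ∈ L v
    colour∈L v = inList (coreOrB v)
    proper : ∀ {x y} (cx : CoreOrB x) (cy : CoreOrB y) → E x y → colourOf cx ≢ colourOf cy
    proper (core i) (core j) e with i Fin.≟ j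
    ... | yes refl = ⊥-elim (E-irrefl (eC i) e)
    ... | no ne = proj₂ (proj₂ coreChoice) i j ne
    proper (core i) (inB b) e = proj₂ (proj₂ (freshB b)) i
    proper (inB b) (core i) e = proj₂ (proj₂ (freshB b)) i ∘ sym
    proper (inB b) (inB b') e = ⊥-elim (¬E-BB b b' e)
    colour-proper : ∀ x y → E x y → colour x ≢ colour y
    colour-proper x y = proper (coreOrB x) (coreOrB y)

  -- the colour (i , c) ∈ Fin r × Fin r, encoded as a number
  pairColour : Fin r → Fin r → ℕ
  pairColour i c = toℕ (combine i c)

  badList : Fin r ⊎ Fin N → List ℕ
  badList (inj₁ i) = map (pairColour i) (allFin r)
  badList (inj₂ b) = map (λ i → pairColour i (toFun b i)) (allFin r)

  badList-size : ∀ c → Unique (badList c) × r ≤ length (badList c)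
  badList-size (inj₁ i) =
    Unique.map⁺ (λ {x} {y} e → Fin.combine-injectiveʳ i x i y (Fin.toℕ-injective e)) (Unique.allFin⁺ r) ,
    ℕ.≤-reflexive (sym (trans (length-map _ (allFin r)) (length-allFin r)))
  badList-size (inj₂ b) =
    Unique.map⁺ (λ {x} {y} e → Fin.combine-injectiveˡ x _ y _ (Fin.toℕ-injective e)) (Unique.allFin⁺ r) ,
    ℕ.≤-reflexive (sym (trans (length-map _ (allFin r)) (length-allFin r)))

  -- lists of size r do not suffice: a choice from the bad lists colours core vertex i by (i , choice i)
  -- for some map choice, and then every colour of the B-vertex fromFun choice is taken by a neighbour
  notChoosable : ¬ Choosable G r
  notChoosable choosable-r = proper (eB b) (eC i) (E-sym (eC i) (eB b) (E-CB i b)) clash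
    where
    chosen = choosable-r (λ v → badList (splitAt r v)) (λ v → badList-size (splitAt r v))
    f = proj₁ chosen
    f∈L = proj₁ (proj₂ chosen)
    proper = proj₂ (proj₂ chosen)
    coreInList : ∀ i → f (eC i) ∈ map (pairColour i) (allFin r)
    coreInList i = subst (λ z → f (eC i) ∈ badList z) (Fin.splitAt-↑ˡ r i N) (f∈L (eC i))
    corePicks : ∀ i → ∃ λ c → c ∈ allFin r × f (eC i) ≡ pairColour i c
    corePicks i = ∈-map⁻ (pairColour i) (coreInList i)
    choice : Fin r → Fin r
    choice i = proj₁ (corePicks i)
    core-colour : ∀ i → f (eC i) ≡ pairColour i (choice i)
    core-colour i = proj₂ (proj₂ (corePicks i))
    b : Fin N
    b = fromFun choice
    bColour : Fin r → ℕ
    bColour i = pairColour i (toFun b i)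
    bInList : f (eB b) ∈ map bColour (allFin r)
    bInList = subst (λ z → f (eB b) ∈ badList z) (Fin.splitAt-↑ʳ r N b) (f∈L (eB b))
    bPicks : ∃ λ i → i ∈ allFin r × f (eB b) ≡ bColour i
    bPicks = ∈-map⁻ bColour bInList
    i : Fin r
    i = proj₁ bPicks
    clash : f (eB b) ≡ f (eC i)
    clash = trans (proj₂ (proj₂ bPicks))
              (trans (cong (pairColour i) (toFun-fromFun choice i)) (sym (core-colour i)))

  listChromaticNumber : ListChromaticNumber G (suc r)
  listChromaticNumber = choosable , λ k k<r+1 choosable-k →
    notChoosable λ L sizes → choosable-k L (λ v → proj₁ (sizes v) , ℕ.≤-trans (ℕ.≤-pred k<r+1) (proj₂ (sizes v)))

  -- The chordal graphs met below are split graphs: Q together with some A- or B-vertices forms a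
  -- clique, and the remaining vertices are independent.

  IsQ IsB : Fin n → Set
  IsQ v = ∃ λ k → v ≡ eQ k
  IsB v = ∃ λ b → v ≡ eB b

  E-Q : ∀ k v → ¬ IsQ v → E (eQ k) v
  E-Q k v notQ = fromView (view v) notQ
    where
    fromView : ∀ {v} → View v → ¬ IsQ v → E (eQ k) v
    fromView (vA j) _ = E-sym (eA j) (eQ k) (E-AQ j k)
    fromView (vQ k') notQ = ⊥-elim (notQ (k' , refl))
    fromView (vB b) _ = E-QB k b

  QExtendsClique : (R : Adj n) (P X : Fin n → Set) → (∀ x y → E x y → P x → P y → R x y) →
    (∀ x → X x → ¬ IsQ x) → (∀ x y → X x → X y → x ≢ y → R x y) →
    ∀ x y → P x × (IsQ x ⊎ X x) → P y × (IsQ y ⊎ X y) → x ≢ y → R x y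
  QExtendsClique R P X R-⊇ notQ cliqueX x y (px , inj₁ (k , refl)) (py , inj₁ (k' , refl)) ne =
    R-⊇ _ _ (E-QQ k k' (λ e → ne (cong eQ e))) px py
  QExtendsClique R P X R-⊇ notQ cliqueX x y (px , inj₁ (k , refl)) (py , inj₂ xy) ne =
    R-⊇ _ _ (E-Q k y (notQ y xy)) px py
  QExtendsClique R P X R-⊇ notQ cliqueX x y (px , inj₂ xx) (py , inj₁ (k , refl)) ne =
    R-⊇ _ _ (E-sym (eQ k) x (E-Q k x (notQ x xx))) px py
  QExtendsClique R P X R-⊇ notQ cliqueX x y (px , inj₂ xx) (py , inj₂ xy) ne = cliqueX x y xx xy ne

  A≢Q : ∀ j → ¬ IsQ (eA j)
  A≢Q j (k , e) = eA≢eQ j k e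

  B≢Q : ∀ b → ¬ IsQ (eB b)
  B≢Q b (k , e) = adjacent⇒distinct (E-QB k b) (sym e)

-- For t = 0 the set A is a single vertex, so A ∪ Q is a clique and B is independent: G is chordal.
chordal-t≡0 : ∀ q → Chordal (Construction.E q 0)
chordal-t≡0 q H = splitNoHole (λ v → ⊤ × (IsQ v ⊎ IsA v)) IsB
  (QExtendsClique E (λ _ → ⊤) IsA (λ x y e _ _ → e) (λ { x (j , refl) → A≢Q j }) oneA)
  (λ { x y (b , refl) (b' , refl) → ¬E-BB b b' }) H (λ i → classify (view (Hole.vs H i)))
  where
  open Construction q 0
  IsA : Fin n → Set
  IsA v = ∃ λ j → v ≡ eA j
  oneA : ∀ x y → IsA x → IsA y → x ≢ y → E x y
  oneA x y (zero , refl) (zero , refl) ne = ⊥-elim (ne refl)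
  classify : ∀ {v} → View v → ⊤ × (IsQ v ⊎ IsA v) ⊎ IsB v
  classify (vA j) = inj₁ (tt , inj₂ (j , refl))
  classify (vQ k) = inj₁ (tt , inj₁ (k , refl))
  classify (vB b) = inj₂ (b , refl)

-- From now on t ≥ 1, so that A and B both have two distinct vertices.
module Index (q t' : ℕ) where

  t : ℕ
  t = suc t'

  open Construction q t

  -- a second vertex of B (r ≥ 2 as t ≥ 1)
  b₁ : Fin N
  b₁ = fromFun (λ _ → suc zero)

  b₀≢b₁ : b₀ ≢ b₁
  b₀≢b₁ e with trans (sym (toFun-fromFun (λ _ → zero) zero)) (trans (cong (λ b → toFun b zero) e) (toFun-fromFun (λ _ → suc zero) zero))
  ... | ()

  pair : {X : Set} → X → X → Fin 2 → X
  pair x y zero = x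
  pair x y (suc zero) = y

  -- Gᵢ in the definition of a local chordalization partition: G*ᵢ₋₁ together with the edges of G
  -- between vertices outside the later parts
  stage : Adj n → List (Sub n) → Adj n
  stage A later = A ∪ᴬ delete E (⋃ later)

  module UpperBound where

    isA : ℕ → Kind a q N → Bool
    isA l (kA j) = toℕ j ≡ᵇ l
    isA l (kQ _) = false
    isA l (kB _) = false

    single : ℕ → Sub n
    single l v = isA l (kindOf v)

    single⇐ : ∀ l i → toℕ i ≡ l → single l (eA i) ≡ true
    single⇐ l i e rewrite kindOf-eA i = Bool.T-≡ .Equivalence.to (ℕ.≡⇒≡ᵇ (toℕ i) l e)

    single⇒ : ∀ l v → single l v ≡ true → ∃ λ i → v ≡ eA i × toℕ i ≡ l
    single⇒ l v = fromView (view v)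
      where
      fromView : ∀ {v} → View v → single l v ≡ true → ∃ λ i → v ≡ eA i × toℕ i ≡ l
      fromView (vA i) h rewrite kindOf-eA i = i , refl , ℕ.≡ᵇ⇒≡ (toℕ i) l (Bool.T-≡ .Equivalence.from h)
      fromView (vQ k) h rewrite kindOf-eQ k = ⊥-elim (true≢false (sym h))
      fromView (vB b) h rewrite kindOf-eB b = ⊥-elim (true≢false (sym h))

    singletons : ℕ → ℕ → List (Sub n)
    singletons j zero = []
    singletons j (suc k) = single j ∷ singletons (suc j) k

    length-singletons : ∀ j k → length (singletons j k) ≡ k
    length-singletons j zero = refl
    length-singletons j (suc k) = cong suc (length-singletons (suc j) k)

    ⋃singletons⇒ : ∀ j k v → ⋃ (singletons j k) v ≡ true → ∃ λ i → v ≡ eA i × j ≤ toℕ i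
    ⋃singletons⇒ j zero v ()
    ⋃singletons⇒ j (suc k) v h with single j v in v∈
    ... | true with single⇒ j v v∈
    ...   | i , e , toℕi = i , e , ℕ.≤-reflexive (sym toℕi)
    ⋃singletons⇒ j (suc k) v h | false with ⋃singletons⇒ (suc j) k v h
    ...   | i , e , j<i = i , e , ℕ.<⇒≤ j<i

    ⋃singletons⇐ : ∀ j k i → j ≤ toℕ i → toℕ i < j + k → ⋃ (singletons j k) (eA i) ≡ true
    ⋃singletons⇐ j zero i j≤i i<j = ⊥-elim (ℕ.<-irrefl refl (ℕ.≤-<-trans j≤i (subst (toℕ i <_) (ℕ.+-identityʳ j) i<j)))
    ⋃singletons⇐ j (suc k) i j≤i i<j+k with ℕ.m≤n⇒m<n∨m≡n j≤i
    ... | inj₂ j≡i = cong (_∨ ⋃ (singletons (suc j) k) (eA i)) (single⇐ j i (sym j≡i))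
    ... | inj₁ j<i = trans (cong (single j (eA i) ∨_) (⋃singletons⇐ (suc j) k i j<i (subst (toℕ i <_) (ℕ.+-suc j k) i<j+k)))
                       (Bool.∨-zeroʳ _)

    LowA : ℕ → Fin n → Set
    LowA j v = ∃ λ i → v ≡ eA i × toℕ i < j

    LowA-mono : ∀ {j v} → LowA j v → LowA (suc j) v
    LowA-mono (i , e , i<j) = i , e , ℕ.≤-trans i<j (ℕ.n≤1+n _)

    ¬LowA-Q : ∀ {j v} → IsQ v → ¬ LowA j v
    ¬LowA-Q (k , refl) (i , e , _) = eA≢eQ i k (sym e)

    ¬LowA-B : ∀ {j v} → IsB v → ¬ LowA j v
    ¬LowA-B (b , refl) (i , e , _) = eA≢eB i b (sym e)

    -- before step j the vertices of the graph are Q, B and a₀, …, a_(j-1)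
    Present : ℕ → Fin n → Set
    Present j v = IsQ v ⊎ IsB v ⊎ LowA j v

    Present-mono : ∀ {j v} → Present j v → Present (suc j) v
    Present-mono (inj₁ q) = inj₁ q
    Present-mono (inj₂ (inj₁ b)) = inj₂ (inj₁ b)
    Present-mono (inj₂ (inj₂ l)) = inj₂ (inj₂ (LowA-mono l))

    present⇒outside : ∀ j k v → Present j v → ⋃ (singletons j k) v ≡ false
    present⇒outside j k v present with ⋃ (singletons j k) v in inside
    ... | false = refl
    ... | true with ⋃singletons⇒ j k v inside | present
    ...   | i , refl , j≤i | inj₁ isQ = ⊥-elim (¬LowA-Q isQ (i , refl , ℕ.≤-refl))
    ...   | i , refl , j≤i | inj₂ (inj₁ isB) = ⊥-elim (¬LowA-B isB (i , refl , ℕ.≤-refl))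
    ...   | i , refl , j≤i | inj₂ (inj₂ (i' , e , i'<j)) with eA-injective e
    ...     | refl = ⊥-elim (ℕ.<-irrefl refl (ℕ.<-≤-trans i'<j j≤i))

    outside⇒present : ∀ j k → j + k ≡ a → ∀ v → ⋃ (singletons j k) v ≡ false → Present j v
    outside⇒present j k j+k v = fromView (view v)
      where
      fromView : ∀ {v} → View v → ⋃ (singletons j k) v ≡ false → Present j v
      fromView (vQ k') _ = inj₁ (k' , refl)
      fromView (vB b) _ = inj₂ (inj₁ (b , refl))
      fromView (vA i) outside with toℕ i ℕ.<? j
      ... | yes i<j = inj₂ (inj₂ (i , refl , i<j))
      ... | no i≮j = ⊥-elim (true≢false (trans (sym (⋃singletons⇐ j k i (ℕ.≮⇒≥ i≮j)
                        (subst (toℕ i <_) (sym j+k) (Fin.toℕ<n i)))) outside))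

    LowPair : ℕ → Fin n → Fin n → Set
    LowPair j x y = LowA j x × LowA j y × x ≢ y

    -- A relation containing the edges of G between present vertices and all pairs among a₀, …, a_(j-1),
    -- in which B is independent, has no hole on present vertices: Q ∪ {a₀, …, a_(j-1)} is a clique.
    noPresentHole : (R : Adj n) (j : ℕ) → (∀ x y → E x y → Present j x → Present j y → R x y) →
      (∀ x y → LowPair j x y → R x y) → (∀ x y → IsB x → IsB y → ¬ R x y) →
      (H : Hole R) → ¬ (∀ i → Present j (Hole.vs H i))
    noPresentHole R j R-⊇E R-⊇low independent H present = splitNoHole K IsB K-clique independent H split
      where
      K : Fin n → Set
      K v = Present j v × (IsQ v ⊎ LowA j v)
      K-clique : ∀ x y → K x → K y → x ≢ y → R x y
      K-clique = QExtendsClique R (Present j) (LowA j) R-⊇E (λ { x (i , refl , _) → A≢Q i })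
                 (λ x y lx ly ne → R-⊇low x y (lx , ly , ne))
      split : ∀ i → K (Hole.vs H i) ⊎ IsB (Hole.vs H i)
      split i with present i
      ... | inj₁ isQ = inj₁ (inj₁ isQ , inj₁ isQ)
      ... | inj₂ (inj₁ isB) = inj₂ isB
      ... | inj₂ (inj₂ low) = inj₁ (inj₂ (inj₂ low) , inj₂ low)

    -- G*_(j-1): the edges of G between present vertices, plus a clique on a₀, …, a_(j-1)
    record Invariant (j : ℕ) (A : Adj n) : Set where
      field
        ⊇E : ∀ x y → E x y → Present j x → Present j y → A x y
        ⊇low : ∀ x y → LowPair j x y → A x y
        ⊆ : ∀ x y → A x y → Present j x × Present j y × (E x y ⊎ LowPair j x y)

    vertexA : ∀ j k → j + suc k ≡ a → Fin a
    vertexA j k j+k = fromℕ< (subst (j <_) j+k (ℕ.m<m+n j (s≤s z≤n)))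

    module Step (j k : ℕ) (j+k : j + suc k ≡ a) (A : Adj n) (inv : Invariant j A) where
      open Invariant inv

      C : Sub n
      C = single j

      R : Adj n
      R = stage A (singletons (suc j) k)

      suc-j+k : suc j + k ≡ a
      suc-j+k = trans (sym (ℕ.+-suc j k)) j+k

      aj : Fin a
      aj = vertexA j k j+k

      toℕ-aj : toℕ aj ≡ j
      toℕ-aj = Fin.toℕ-fromℕ< _

      aj∈C : C (eA aj) ≡ true
      aj∈C = single⇐ j aj toℕ-aj

      C⇒aj : ∀ u → C u ≡ true → u ≡ eA aj
      C⇒aj u u∈C with single⇒ j u u∈C
      ... | i , refl , toℕi = cong eA (Fin.toℕ-injective (trans toℕi (sym toℕ-aj)))

      LowA-aj : LowA (suc j) (eA aj)
      LowA-aj = aj , refl , ℕ.≤-reflexive (cong suc toℕ-aj)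

      ¬LowA-aj : ¬ LowA j (eA aj)
      ¬LowA-aj (i , e , i<j) with eA-injective e
      ... | refl = ℕ.<-irrefl toℕ-aj i<j

      LowA-split : ∀ {v} → LowA (suc j) v → LowA j v ⊎ v ≡ eA aj
      LowA-split (i , e , i<j+1) with ℕ.m≤n⇒m<n∨m≡n (ℕ.≤-pred i<j+1)
      ... | inj₁ i<j = inj₁ (i , e , i<j)
      ... | inj₂ i≡j = inj₂ (trans e (cong eA (Fin.toℕ-injective (trans i≡j (sym toℕ-aj)))))

      R-⊇E : ∀ x y → E x y → Present (suc j) x → Present (suc j) y → R x y
      R-⊇E x y e px py = inj₂ (e , present⇒outside (suc j) k x px , present⇒outside (suc j) k y py)

      R-⊆ : ∀ x y → R x y → Present (suc j) x × Present (suc j) y × (E x y ⊎ LowPair j x y)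
      R-⊆ x y (inj₁ h) with ⊆ x y h
      ... | px , py , edge = Present-mono px , Present-mono py , edge
      R-⊆ x y (inj₂ (e , ox , oy)) =
        outside⇒present (suc j) k suc-j+k x ox , outside⇒present (suc j) k suc-j+k y oy , inj₁ e

      R-B-independent : ∀ x y → IsB x → IsB y → ¬ R x y
      R-B-independent x y (b , refl) (b' , refl) h with R-⊆ _ _ h
      ... | _ , _ , inj₁ e = ¬E-BB b b' e
      ... | _ , _ , inj₂ (lx , _) = ¬LowA-B (b , refl) lx

      -- every hole of Gⱼ passes through a_j, since the vertices present before step j carry no hole
      throughAj : ∀ (H : Hole R) → InHole H (eA aj)
      throughAj H with Fin.any? (λ i → Hole.vs H i Fin.≟ eA aj)
      ... | yes found = found
      ... | no avoids = ⊥-elim (noPresentHole R j (λ x y e px py → R-⊇E x y e (Present-mono px) (Present-mono py))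
                          (λ x y low → inj₁ (⊇low x y low)) R-B-independent H presentBefore)
        where
        presentBefore : ∀ i → Present j (Hole.vs H i)
        presentBefore i with inHole⇒nonIsolated H (i , refl)
        ... | w , h with proj₁ (R-⊆ _ _ h)
        ...   | inj₁ isQ = inj₁ isQ
        ...   | inj₂ (inj₁ isB) = inj₂ (inj₁ isB)
        ...   | inj₂ (inj₂ low) with LowA-split low
        ...     | inj₁ low' = inj₂ (inj₂ low')
        ...     | inj₂ e = ⊥-elim (avoids (i , e))

      coverHole : HoleCover R C
      coverHole = (eA aj , aj∈C) , λ H → let (i , e) = throughAj H in i , trans (cong C e) aj∈C

      -- C = {a_j} lies on every hole, so the NC property holds trivially
      ncSet : NCset R C
      ncSet = ncVertex , λ H u v _ _ u∈C v∈C → trans (C⇒aj u u∈C) (sym (C⇒aj v v∈C))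
        where
        ncVertex : ∀ u → C u ≡ true → NCvertex R u
        ncVertex u u∈C H₁ H₂ _ u∉H₂ _ with throughAj H₂
        ... | i , e = u∉H₂ (i , trans e (sym (C⇒aj u u∈C)))

      -- for i < j, a_j b₀ a_i b₁ is a square of Gⱼ, so chordalizing at a_j joins a_j to a_i
      squareThroughAj : ∀ i → toℕ i < j → Square R (eA ∘ pair aj i) (eB ∘ pair b₀ b₁)
      squareThroughAj i i<j = record
        { s-distinct = λ e → ℕ.<-irrefl (trans (cong toℕ (sym (eA-injective e))) toℕ-aj) i<j
        ; t-distinct = λ e → b₀≢b₁ (eB-injective e)
        ; st = λ x y → R-⊇E _ _ (E-AB (sA x) (tB y)) (presentS x) (presentT y)
        ; ts = λ x y → R-⊇E _ _ (E-sym (eA (sA x)) (eB (tB y)) (E-AB (sA x) (tB y))) (presentT y) (presentS x)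
        ; ¬ss = ¬ss
        ; ¬tt = λ x y → R-B-independent _ _ (tB x , refl) (tB y , refl)
        }
        where
        sA : Fin 2 → Fin a
        sA = pair aj i
        tB : Fin 2 → Fin N
        tB = pair b₀ b₁
        presentS : ∀ x → Present (suc j) (eA (sA x))
        presentS zero = inj₂ (inj₂ LowA-aj)
        presentS (suc zero) = inj₂ (inj₂ (LowA-mono (i , refl , i<j)))
        presentT : ∀ y → Present (suc j) (eB (tB y))
        presentT y = inj₂ (inj₁ (tB y , refl))
        ¬ss : ∀ x y → ¬ R (eA (sA x)) (eA (sA y))
        ¬ss x y h with R-⊆ _ _ h
        ... | _ , _ , inj₁ e = ¬E-AA (sA x) (sA y) e
        ¬ss zero y h | _ , _ , inj₂ (lx , _) = ¬LowA-aj lx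
        ¬ss (suc zero) zero h | _ , _ , inj₂ (_ , ly , _) = ¬LowA-aj ly
        ¬ss (suc zero) (suc zero) h | _ , _ , inj₂ (_ , _ , ne) = ne refl

      hat-⊇low : ∀ x y → LowPair (suc j) x y → hat R C x y
      hat-⊇low x y (lx , ly , ne) with LowA-split lx | LowA-split ly
      ... | inj₁ lx' | inj₁ ly' = hat-⊇ R C x y (inj₁ (⊇low x y (lx' , ly' , ne)))
      ... | inj₂ refl | inj₁ (i , refl , i<j) = hat-singleton R C (eA aj) C⇒aj aj∈C _ _
            (inj₂ (inj₁ (refl , (λ e → ne (sym e)) , squareHole (squareThroughAj i i<j) , (zero , refl) , (suc (suc zero) , refl))))
      ... | inj₁ (i , refl , i<j) | inj₂ refl = hat-singleton R C (eA aj) C⇒aj aj∈C _ _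
            (inj₂ (inj₂ (refl , ne , squareHole (squareThroughAj i i<j) , (zero , refl) , (suc (suc zero) , refl))))
      ... | inj₂ refl | inj₂ refl = ⊥-elim (ne refl)

      chordAtAj : ∀ y → Present (suc j) y → eA aj ≢ y → E (eA aj) y ⊎ LowPair (suc j) (eA aj) y
      chordAtAj y (inj₁ (k , refl)) _ = inj₁ (E-AQ aj k)
      chordAtAj y (inj₂ (inj₁ (b , refl))) _ = inj₁ (E-AB aj b)
      chordAtAj y (inj₂ (inj₂ low)) ne = inj₂ (LowA-aj , low , ne)

      flipped : ∀ {x y} → E x y ⊎ LowPair (suc j) x y → E y x ⊎ LowPair (suc j) y x
      flipped {x} {y} (inj₁ e) = inj₁ (E-sym x y e)
      flipped (inj₂ (lx , ly , ne)) = inj₂ (ly , lx , λ e → ne (sym e))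

      hat-⊆E : ∀ x y → hat R C x y → Present (suc j) x × Present (suc j) y × (E x y ⊎ LowPair (suc j) x y)
      hat-⊆E x y h with hat-⊆ R C x y h
      ... | inj₁ r with R-⊆ x y r
      ...   | px , py , inj₁ e = px , py , inj₁ e
      ...   | px , py , inj₂ (lx , ly , ne) = px , py , inj₂ (LowA-mono lx , LowA-mono ly , ne)
      hat-⊆E x y h | inj₂ (ne , (w , rx) , (w' , ry) , inj₁ x∈C) with C⇒aj x x∈C
      ... | refl = proj₁ (R-⊆ _ _ rx) , proj₁ (R-⊆ _ _ ry) , chordAtAj y (proj₁ (R-⊆ _ _ ry)) ne
      hat-⊆E x y h | inj₂ (ne , (w , rx) , (w' , ry) , inj₂ y∈C) with C⇒aj y y∈C
      ... | refl = proj₁ (R-⊆ _ _ rx) , proj₁ (R-⊆ _ _ ry) , flipped (chordAtAj x (proj₁ (R-⊆ _ _ rx)) (λ e → ne (sym e)))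

      next : Invariant (suc j) (hat R C)
      next = record { ⊇E = λ x y e px py → hat-⊇ R C x y (R-⊇E x y e px py) ; ⊇low = hat-⊇low ; ⊆ = hat-⊆E }

      chordalHat : Chordal (hat R C)
      chordalHat H = noPresentHole (hat R C) (suc j) (Invariant.⊇E next) hat-⊇low independent H
                       (λ i → proj₁ (hat-⊆E _ _ (proj₂ (inHole⇒nonIsolated H (i , refl)))))
        where
        independent : ∀ x y → IsB x → IsB y → ¬ hat R C x y
        independent x y (b , refl) (b' , refl) h with proj₂ (proj₂ (hat-⊆E _ _ h))
        ... | inj₁ e = ¬E-BB b b' e
        ... | inj₂ (lx , _) = ¬LowA-B (b , refl) lx

    partitionSteps : ∀ k j → j + k ≡ a → ∀ A → Invariant j A → LCPsteps E A (singletons j k)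
    partitionSteps zero j _ A inv = tt
    partitionSteps (suc k) j j+k A inv =
      coverHole , ncSet , chordalHat , partitionSteps k (suc j) suc-j+k (hat R C) next
      where open Step j k j+k A inv

    parts : List (Sub n)
    parts = singletons 1 t

    lowA₁-unique : ∀ {x y} → LowA 1 x → LowA 1 y → x ≡ y
    lowA₁-unique (i , refl , i<1) (i' , refl , i'<1) =
      cong eA (Fin.toℕ-injective (trans (ℕ.n<1⇒n≡0 i<1) (sym (ℕ.n<1⇒n≡0 i'<1))))

    initial : Invariant 1 (delete E (⋃ parts))
    initial = record
      { ⊇E = λ x y e px py → e , present⇒outside 1 t x px , present⇒outside 1 t y py
      ; ⊇low = λ x y (lx , ly , ne) → ⊥-elim (ne (lowA₁-unique lx ly))
      ; ⊆ = λ x y (e , ox , oy) → outside⇒present 1 t refl x ox , outside⇒present 1 t refl y oy , inj₁ e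
      }

    -- every hole of G meets {a₁, …, a_t}: outside of it, Q ∪ {a₀} is a clique and B independent
    coversG : HoleCover E (⋃ parts)
    coversG = (eA (suc zero) , ⋃singletons⇐ 1 t (suc zero) ℕ.≤-refl (s≤s (s≤s z≤n))) , cover
      where
      cover : ∀ (H : Hole E) → ∃ λ i → ⋃ parts (Hole.vs H i) ≡ true
      cover H with Fin.any? (λ i → ⋃ parts (Hole.vs H i) Bool.≟ true)
      ... | yes found = found
      ... | no avoids = ⊥-elim (noPresentHole E 1 (λ x y e _ _ → e)
                          (λ x y (lx , ly , ne) → ⊥-elim (ne (lowA₁-unique lx ly)))
                          (λ { x y (b , refl) (b' , refl) → ¬E-BB b b' }) H
                          (λ i → outside⇒present 1 t refl _ (Bool.¬-not (λ e → avoids (i , e)))))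

    nonempty : ∀ j k → j + k ≡ a → All NonemptySub (singletons j k)
    nonempty j zero _ = []
    nonempty j (suc k) j+k = (eA (vertexA j k j+k) , single⇐ j _ (Fin.toℕ-fromℕ< _))
                             ∷ nonempty (suc j) k (trans (sym (ℕ.+-suc j k)) j+k)

    disjoint : ∀ j k → PairwiseDisjoint (singletons j k)
    disjoint j zero = tt
    disjoint j (suc k) = laterParts , disjoint (suc j) k
      where
      laterParts : ∀ x → single j x ≡ true → ⋃ (singletons (suc j) k) x ≡ false
      laterParts x x∈ with single⇒ j x x∈
      ... | i , refl , toℕi = present⇒outside (suc j) k _ (inj₂ (inj₂ (i , refl , ℕ.≤-reflexive (cong suc toℕi))))

    hasLCP : HasLCP G t
    hasLCP = parts , length-singletons 1 t ,
      (nonempty 1 t refl , disjoint 1 t , coversG , partitionSteps t 1 refl (delete E (⋃ parts)) initial)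

  module LowerBound where

    Avoids : Adj n → List (Sub n) → Set
    Avoids A Cs = ∀ x y → A x y → x ≢ y × ⋃ Cs x ≡ false × ⋃ Cs y ≡ false

    stage-avoids : ∀ A C later → Avoids A (C ∷ later) → Avoids (stage A later) later
    stage-avoids A C later avoids x y (inj₁ h) with avoids x y h
    ... | ne , ox , oy = ne , proj₂ (∨-false ox) , proj₂ (∨-false oy)
    stage-avoids A C later avoids x y (inj₂ (e , ox , oy)) = adjacent⇒distinct e , ox , oy

    -- new chords join non-isolated, hence surviving, vertices
    hat-avoids : ∀ R C later → Avoids R later → Avoids (hat R C) later
    hat-avoids R C later avoids x y h with hat-⊆ R C x y h
    ... | inj₁ r = avoids x y r
    ... | inj₂ (ne , (w , rx) , (w' , ry) , _) = ne , proj₁ (proj₂ (avoids x w rx)) , proj₁ (proj₂ (avoids y w' ry))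

    stage-⊆E : ∀ A later → (∀ x y → A x y → E x y) → ∀ x y → stage A later x y → E x y
    stage-⊆E A later A⊆E x y (inj₁ h) = A⊆E x y h
    stage-⊆E A later A⊆E x y (inj₂ (e , _)) = e

    record Side : Set where
      field
        p p' : ℕ
        eS : Fin p → Fin n
        eT : Fin p' → Fin n
        S-injective : ∀ {i j} → eS i ≡ eS j → i ≡ j
        T-injective : ∀ {i j} → eT i ≡ eT j → i ≡ j
        E-ST : ∀ i j → E (eS i) (eT j)
        ¬E-SS : ∀ i j → ¬ E (eS i) (eS j)
        ¬E-TT : ∀ i j → ¬ E (eT i) (eT j)
        S-notQ : ∀ i → ¬ IsQ (eS i)
        T-notQ : ∀ j → ¬ IsQ (eT j)
        classify : ∀ v → IsQ v ⊎ (∃ λ i → v ≡ eS i) ⊎ (∃ λ j → v ≡ eT j)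
        S-large : suc t ≤ p
        T-large : suc t ≤ p'
        s₀ s₁ : Fin p
        s₀≢s₁ : s₀ ≢ s₁
        t₀ t₁ : Fin p'
        t₀≢t₁ : t₀ ≢ t₁

    swapSides : Side → Side
    swapSides sd = record
      { p = p' ; p' = p ; eS = eT ; eT = eS ; S-injective = T-injective ; T-injective = S-injective
      ; E-ST = λ j i → E-sym (eS i) (eT j) (E-ST i j) ; ¬E-SS = ¬E-TT ; ¬E-TT = ¬E-SS
      ; S-notQ = T-notQ ; T-notQ = S-notQ ; classify = swapped ; S-large = T-large ; T-large = S-large
      ; s₀ = t₀ ; s₁ = t₁ ; s₀≢s₁ = t₀≢t₁ ; t₀ = s₀ ; t₁ = s₁ ; t₀≢t₁ = s₀≢s₁ }
      where
      open Side sd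
      swapped : ∀ v → IsQ v ⊎ (∃ λ j → v ≡ eT j) ⊎ (∃ λ i → v ≡ eS i)
      swapped v with classify v
      ... | inj₁ isQ = inj₁ isQ
      ... | inj₂ (inj₁ inS) = inj₂ (inj₂ inS)
      ... | inj₂ (inj₂ inT) = inj₂ (inj₁ inT)

    sideAB : Side
    sideAB = record
      { p = a ; p' = N ; eS = eA ; eT = eB ; S-injective = eA-injective ; T-injective = eB-injective
      ; E-ST = E-AB ; ¬E-SS = ¬E-AA ; ¬E-TT = ¬E-BB ; S-notQ = A≢Q ; T-notQ = B≢Q ; classify = classifyAB
      ; S-large = ℕ.≤-refl ; T-large = ℕ.≤-trans (ℕ.m≤m+n a q) r≤N
      ; s₀ = zero ; s₁ = suc zero ; s₀≢s₁ = λ () ; t₀ = b₀ ; t₁ = b₁ ; t₀≢t₁ = b₀≢b₁ }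
      where
      classifyAB : ∀ v → IsQ v ⊎ (∃ λ j → v ≡ eA j) ⊎ (∃ λ b → v ≡ eB b)
      classifyAB v with view v
      ... | vA j = inj₂ (inj₁ (j , refl))
      ... | vQ k = inj₁ (k , refl)
      ... | vB b = inj₂ (inj₂ (b , refl))

    Covers : Side → Sub n → Set
    Covers sd X = AtMostOne (λ i → not (X (Side.eS sd i)))

    module OnSide (sd : Side) where
      open Side sd

      squareE : (s : Fin 2 → Fin p) (u : Fin 2 → Fin p') → s zero ≢ s (suc zero) → u zero ≢ u (suc zero) →
        Square E (eS ∘ s) (eT ∘ u)
      squareE s u s≢ u≢ = record
        { s-distinct = s≢ ∘ S-injective ; t-distinct = u≢ ∘ T-injective
        ; st = λ i j → E-ST (s i) (u j) ; ts = λ i j → E-sym (eS (s i)) (eT (u j)) (E-ST (s i) (u j))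
        ; ¬ss = λ i j → ¬E-SS (s i) (s j) ; ¬tt = λ i j → ¬E-TT (u i) (u j) }

      squareStage : ∀ A later (s : Fin 2 → Fin p) (u : Fin 2 → Fin p') → s zero ≢ s (suc zero) → u zero ≢ u (suc zero) →
        (∀ i → ⋃ later (eS (s i)) ≡ false) → (∀ j → ⋃ later (eT (u j)) ≡ false) →
        (∀ i j → ¬ A (eS (s i)) (eS (s j))) → (∀ i j → ¬ A (eT (u i)) (eT (u j))) →
        Square (stage A later) (eS ∘ s) (eT ∘ u)
      squareStage A later s u s≢ u≢ s-out u-out ¬ss ¬tt = record
        { s-distinct = Square.s-distinct sq ; t-distinct = Square.t-distinct sq
        ; st = λ i j → inj₂ (Square.st sq i j , s-out i , u-out j)
        ; ts = λ i j → inj₂ (Square.ts sq i j , u-out j , s-out i)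
        ; ¬ss = λ { i j (inj₁ h) → ¬ss i j h ; i j (inj₂ (e , _)) → Square.¬ss sq i j e }
        ; ¬tt = λ { i j (inj₁ h) → ¬tt i j h ; i j (inj₂ (e , _)) → Square.¬tt sq i j e } }
        where
        sq = squareE s u s≢ u≢

      -- If X covers all but one vertex of S, a relation consisting of the edges of G outside X is a split
      -- graph: Q and the remaining vertex of S form a clique and T is independent.
      coveredChordal : (X : Sub n) (R : Adj n) → (∀ x y → R x y → X x ≡ false × X y ≡ false × E x y) →
        (∀ x y → E x y → X x ≡ false → X y ≡ false → R x y) → Covers sd X → Chordal R
      coveredChordal X R R-⊆ R-⊇ covers H = splitNoHole K IsT K-clique T-independent H split
        where
        IsS IsT K : Fin n → Set
        IsS v = ∃ λ i → v ≡ eS i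
        IsT v = ∃ λ j → v ≡ eT j
        K v = X v ≡ false × (IsQ v ⊎ (X v ≡ false × IsS v))
        K-clique : ∀ x y → K x → K y → x ≢ y → R x y
        K-clique = QExtendsClique R (λ v → X v ≡ false) (λ v → X v ≡ false × IsS v) R-⊇
          (λ { x (_ , i , refl) → S-notQ i })
          (λ { x y (ox , i , refl) (oy , j , refl) ne → ⊥-elim (ne (cong eS (covers i j (not-false ox) (not-false oy)))) })
        T-independent : ∀ x y → IsT x → IsT y → ¬ R x y
        T-independent x y (i , refl) (j , refl) h = ¬E-TT i j (proj₂ (proj₂ (R-⊆ _ _ h)))
        split : ∀ i → K (Hole.vs H i) ⊎ IsT (Hole.vs H i)
        split i with inHole⇒nonIsolated H (i , refl)
        ... | w , h with proj₁ (R-⊆ _ _ h) | classify (Hole.vs H i)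
        ...   | out | inj₁ isQ = inj₁ (out , inj₁ isQ)
        ...   | out | inj₂ (inj₁ isS) = inj₁ (out , inj₂ (out , isS))
        ...   | out | inj₂ (inj₂ isT) = inj₂ isT

      record SurvivingPair (A : Adj n) (X : Sub n) : Set where
        field
          u : Fin 2 → Fin p'
          u-distinct : u zero ≢ u (suc zero)
          outside : ∀ j → X (eT (u j)) ≡ false
          apart : ∀ i j → ¬ A (eT (u i)) (eT (u j))

      -- While a pair of T survives, a part C contains at most one vertex of S: two of them would lie on a
      -- common square of the stage graph, against the NC property.
      onePerPart : ∀ A C later → (∀ x → C x ≡ true → ⋃ later x ≡ false) → Avoids A (C ∷ later) →
        SurvivingPair A (⋃ (C ∷ later)) → NCset (stage A later) C → AtMostOne (λ i → C (eS i))
      onePerPart A C later disjoint avoids surviving nc i j i∈C j∈C with i Fin.≟ j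
      ... | yes i≡j = i≡j
      ... | no i≢j = ⊥-elim (i≢j (S-injective (proj₂ nc (squareHole sq) (eS i) (eS j) (zero , refl) (suc (suc zero) , refl) i∈C j∈C)))
        where
        open SurvivingPair surviving
        inC : ∀ x → C (eS (pair i j x)) ≡ true
        inC zero = i∈C
        inC (suc zero) = j∈C
        sq = squareStage A later (pair i j) u i≢j u-distinct (λ x → disjoint _ (inC x)) (λ y → proj₂ (∨-false (outside y)))
               (λ x y h → true≢false (trans (sym (inC x)) (proj₁ (∨-false (proj₁ (proj₂ (avoids _ _ h))))))) apart

      -- the pair survives the step at C: new chords end in C, which the pair avoids
      survives : ∀ A C later → SurvivingPair A (⋃ (C ∷ later)) → SurvivingPair (hat (stage A later) C) (⋃ later)
      survives A C later surviving = record
        { u = u ; u-distinct = u-distinct ; outside = λ j → proj₂ (∨-false (outside j)) ; apart = apart' }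
        where
        open SurvivingPair surviving
        notInC : ∀ j → C (eT (u j)) ≢ true
        notInC j j∈C = true≢false (trans (sym j∈C) (proj₁ (∨-false (outside j))))
        apart' : ∀ i j → ¬ hat (stage A later) C (eT (u i)) (eT (u j))
        apart' i j h with hat-⊆ (stage A later) C _ _ h
        ... | inj₁ (inj₁ a) = apart i j a
        ... | inj₁ (inj₂ (e , _)) = ¬E-TT (u i) (u j) e
        ... | inj₂ (_ , _ , _ , inj₁ i∈C) = notInC i i∈C
        ... | inj₂ (_ , _ , _ , inj₂ j∈C) = notInC j j∈C

      sideCount : ∀ Cs A → PairwiseDisjoint Cs → Avoids A Cs → SurvivingPair A (⋃ Cs) → LCPsteps E A Cs →
        count p (λ i → ⋃ Cs (eS i)) ≤ length Cs
      sideCount [] A _ _ _ _ = ℕ.≤-reflexive (count-none p _ (λ _ → refl))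
      sideCount (C ∷ later) A (disjoint , disjoints) avoids surviving (_ , nc , _ , steps) =
        ℕ.≤-trans (count-∨ p (λ i → C (eS i)) (λ i → ⋃ later (eS i)))
          (ℕ.+-mono-≤ (count-atMostOne p _ (onePerPart A C later disjoint avoids surviving nc))
            (sideCount later (hat (stage A later) C) disjoints
              (hat-avoids (stage A later) C later (stage-avoids A C later avoids)) (survives A C later surviving) steps))

      coveredCount : ∀ X L → Covers sd X → count p (λ i → X (eS i)) ≤ L → t ≤ L
      coveredCount X L covers few = ℕ.≤-pred (begin
        suc t                                                     ≤⟨ S-large ⟩
        p                                                         ≡⟨ sym (count-complement p (λ i → X (eS i))) ⟩
        count p (λ i → X (eS i)) + count p (λ i → not (X (eS i))) ≤⟨ ℕ.+-mono-≤ few (count-atMostOne p _ covers) ⟩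
        L + 1                                                     ≡⟨ ℕ.+-comm L 1 ⟩
        suc L                                                     ∎)
        where open ℕ.≤-Reasoning

      -- The step at C, when both sides keep two vertices outside the later parts but S is covered after C.
      -- If two vertices of T stay outside C as well, count the parts; otherwise C contains a vertex of S
      -- and a vertex of T lying on a common square, against the NC property.
      entering : ∀ A C later → PairwiseDisjoint (C ∷ later) → Avoids A (C ∷ later) → (∀ x y → A x y → E x y) →
        LCPsteps E A (C ∷ later) → TwoOf (λ i → not (⋃ later (eS i))) → TwoOf (λ j → not (⋃ later (eT j))) →
        Covers sd (⋃ (C ∷ later)) → t ≤ length (C ∷ later)
      entering A C later (disjoint , disjoints) avoids A⊆E steps twoS twoT covers
        with twoOrAtMostOne (λ j → not (⋃ (C ∷ later) (eT j)))
      ... | inj₁ (j₀ , j₁ , j₀≢j₁ , out₀ , out₁) =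
        coveredCount (⋃ (C ∷ later)) _ covers (sideCount (C ∷ later) A (disjoint , disjoints) avoids surviving steps)
        where
        surviving : SurvivingPair A (⋃ (C ∷ later))
        surviving = record
          { u = pair j₀ j₁ ; u-distinct = j₀≢j₁
          ; outside = λ { zero → not-true out₀ ; (suc zero) → not-true out₁ }
          ; apart = λ i j h → ¬E-TT _ _ (A⊆E _ _ h) }
      ... | inj₂ coversT = ⊥-elim (adjacent⇒distinct (E-ST (z newS) (z newT))
                             (proj₂ (proj₁ (proj₂ steps)) (squareHole sq) _ _ (zero , refl) (suc zero , refl) (inC newS) (inC newT)))
        where
        open Entering
        newS = enteringPair (λ i → ⋃ later (eS i)) (λ i → ⋃ (C ∷ later) (eS i)) twoS covers
        newT = enteringPair (λ j → ⋃ later (eT j)) (λ j → ⋃ (C ∷ later) (eT j)) twoT coversT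
        inC : ∀ {m} {e : Fin m → Fin n} → (new : Entering (λ i → ⋃ later (e i)) (λ i → ⋃ (C ∷ later) (e i))) → C (e (z new)) ≡ true
        inC new = ∨-true (z∈Q new) (z∉P new)
        outside : ∀ {m} {e : Fin m → Fin n} → (new : Entering (λ i → ⋃ later (e i)) (λ i → ⋃ (C ∷ later) (e i))) →
          ∀ x → ⋃ later (e (pair (z new) (z' new) x)) ≡ false
        outside new zero = z∉P new
        outside new (suc zero) = z'∉P new
        sq = squareStage A later (pair (z newS) (z' newS)) (pair (z newT) (z' newT)) (z≢z' newS) (z≢z' newT)
               (outside newS) (outside newT) (λ i j h → ¬E-SS _ _ (A⊆E _ _ h)) (λ i j h → ¬E-TT _ _ (A⊆E _ _ h))

    -- When the later parts cover all but one vertex of a side, the stage graph is chordal, so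
    -- chordalizing changes nothing and G*ᵢ still consists of edges of G avoiding the later parts.
    chordalStep : ∀ A C later → Avoids A (C ∷ later) → (∀ x y → A x y → E x y) → (sd : Side) → Covers sd (⋃ later) →
      Avoids (hat (stage A later) C) later × (∀ x y → hat (stage A later) C x y → E x y)
    chordalStep A C later avoids A⊆E sd covers =
      (λ x y h → stage-avoids A C later avoids x y (unchanged x y h)) , (λ x y h → stage-⊆E A later A⊆E x y (unchanged x y h))
      where
      R : Adj n
      R = stage A later
      R-⊆ : ∀ x y → R x y → ⋃ later x ≡ false × ⋃ later y ≡ false × E x y
      R-⊆ x y h with stage-avoids A C later avoids x y h
      ... | _ , ox , oy = ox , oy , stage-⊆E A later A⊆E x y h
      unchanged : ∀ x y → hat R C x y → R x y
      unchanged = hat-chordal R C (OnSide.coveredChordal sd (⋃ later) R R-⊆ (λ x y e ox oy → inj₂ (e , ox , oy)) covers)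

    -- A step
    -- after which the remaining parts still cover a side is skipped; otherwise `entering` applies.
    enoughParts : ∀ Cs A → PairwiseDisjoint Cs → Avoids A Cs → (∀ x y → A x y → E x y) →
      Σ Side (λ sd → Covers sd (⋃ Cs)) → LCPsteps E A Cs → t ≤ length Cs
    enoughParts [] A _ _ _ (sd , covers) _ = ⊥-elim (s₀≢s₁ (covers s₀ s₁ refl refl))
      where open Side sd
    enoughParts (C ∷ later) A (disjoint , disjoints) avoids A⊆E (sd , covers) steps
      with twoOrAtMostOne (λ i → not (⋃ later (Side.eS sd i))) | twoOrAtMostOne (λ j → not (⋃ later (Side.eT sd j)))
    ... | inj₂ coversS | _ =
      ℕ.≤-trans (enoughParts later _ disjoints (proj₁ next) (proj₂ next) (sd , coversS) (proj₂ (proj₂ (proj₂ steps)))) (ℕ.n≤1+n _)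
      where next = chordalStep A C later avoids A⊆E sd coversS
    ... | inj₁ _ | inj₂ coversT =
      ℕ.≤-trans (enoughParts later _ disjoints (proj₁ next) (proj₂ next) (swapSides sd , coversT) (proj₂ (proj₂ (proj₂ steps)))) (ℕ.n≤1+n _)
      where next = chordalStep A C later avoids A⊆E (swapSides sd) coversT
    ... | inj₁ twoS | inj₁ twoT = OnSide.entering sd A C later (disjoint , disjoints) avoids A⊆E steps twoS twoT covers

    -- a hole cover of G covers all but one vertex of A or of B, for otherwise a square of G avoids it
    coveredSide : ∀ X → HoleCover E X → Σ Side (λ sd → Covers sd X)
    coveredSide X (_ , cover) with twoOrAtMostOne (λ i → not (X (eA i))) | twoOrAtMostOne (λ b → not (X (eB b)))
    ... | inj₂ coversA | _ = sideAB , coversA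
    ... | inj₁ _ | inj₂ coversB = swapSides sideAB , coversB
    ... | inj₁ (i₀ , i₁ , i₀≢i₁ , out-i₀ , out-i₁) | inj₁ (j₀ , j₁ , j₀≢j₁ , out-j₀ , out-j₁) =
      ⊥-elim (true≢false (trans (sym (proj₂ (cover H))) (avoids (proj₁ (cover H)))))
      where
      H : Hole E
      H = squareHole (OnSide.squareE sideAB (pair i₀ i₁) (pair j₀ j₁) i₀≢i₁ j₀≢j₁)
      avoids : ∀ x → X (Hole.vs H x) ≡ false
      avoids zero = not-true out-i₀
      avoids (suc zero) = not-true out-j₀
      avoids (suc (suc zero)) = not-true out-i₁
      avoids (suc (suc (suc zero))) = not-true out-j₁

    lowerBound : ∀ k → k < t → ¬ HasLCP G k
    lowerBound k k<t (Cs , length≡k , _ , disjoint , cover , steps) =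
      ℕ.<⇒≱ k<t (subst (t ≤_) length≡k
        (enoughParts Cs (delete E (⋃ Cs)) disjoint avoids₀ (λ _ _ → proj₁) (coveredSide (⋃ Cs) cover) steps))
      where
      avoids₀ : Avoids (delete E (⋃ Cs)) Cs
      avoids₀ x y (e , ox , oy) = adjacent⇒distinct e , ox , oy

  notChordal : ¬ Chordal E
  notChordal chordal = chordal (squareHole (LowerBound.OnSide.squareE LowerBound.sideAB (pair zero (suc zero)) (pair b₀ b₁) (λ ()) b₀≢b₁))

  nonChordalityIndex : NonChordalityIndex G t
  nonChordalityIndex = inj₂ (notChordal , UpperBound.hasLCP , LowerBound.lowerBound)

nonChordalityIndex : ∀ q t → NonChordalityIndex (Construction.G q t) t
nonChordalityIndex q zero = inj₁ (chordal-t≡0 q , refl)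
nonChordalityIndex q (suc t') = Index.nonChordalityIndex q t'

theorem4p11 : (s t : ℕ) → 1 ≤ s →
    Σ Graph (λ G → ChromaticNumber G (suc s) × CliqueNumber G (suc s)
    × NonChordalityIndex G t × ListChromaticNumber G (suc (s + t)))
theorem4p11 (suc q) t _ =
  G , chromaticNumber , cliqueNumber , nonChordalityIndex q t ,
  subst (ListChromaticNumber G) (cong (λ z → suc (suc z)) (ℕ.+-comm t q)) listChromaticNumber
  where open Construction q t
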